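{- Let $G$ be a graph with a proper 2-separator $\{a,b\}$ and split $(X,\{a,b\},Y)$, and let $G_X$, $G_Y$ be its blocks of decomposition (for any choice of the paths $P$, $Q$). Then $G$ is theta-free (respectively triangle-free, wac-free, turtle-free, c-wac-free, even-hole-free, prism-free, even-wheel-free, bipartite) if and only if both $G_X$ and $G_Y$ are theta-free (respectively triangle-free, wac-free, turtle-free, c-wac-free, even-hole-free, prism-free, even-wheel-free, bipartite).
   Context: Graphs are finite and simple; $H$-free means no induced subgraph isomorphic to $H$. A path means an induced path; an $ab$-path has ends $a,b$; for $X\subseteq V(G)$ an $aXb$-path is an $ab$-path with all internal vertices in $X$. A hole is a chordless cycle of length at least $4$, even if its length is even; a triangle is $K_3$. A theta: three paths between nonadjacent $a,b$, each of length at least $2$, pairwise sharing only $a,b$, no other edges. A prism: three vertex-disjoint paths $a_1\dots b_1,a_2\dots b_2,a_3\dots b_3$ of length at least $1$ with $a_1a_2a_3$ and $b_1b_2b_3$ triangles and no other edges between the paths. A wheel $(H,c)$: a hole $H$ with a vertex $c$ having at least three neighbours in $H$; even if that number is even; a sector is a subpath of $H$ of length at least $1$ whose ends are adjacent to $c$ and internal vertices are not. A wac $(H,x,y)$: a hole $H$ with adjacent $x,y$ such that $(H,x)$, $(H,y)$ are wheels; it is a turtle if for some naming some sector of $(H,y)$ contains all neighbours of $x$ in $H$, a c-wac otherwise. A proper 2-separator of $G$ is a set $\{a,b\}$ of two nonadjacent vertices such that $G\setminus\{a,b\}$ has exactly two components $X,Y$ and, for each $Z\in\{X,Y\}$, $G$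 contains an $aZb$-path and $G[Z\cup\{a,b\}]$ is not itself an $ab$-path; $(X,\{a,b\},Y)$ is the split. The blocks of decomposition are $G_X=G[X\cup\{a,b\}\cup V(Q)]$ and $G_Y=G[V(P)\cup\{a,b\}\cup Y]$, where $Q$ is an $aYb$-path and $P$ is an $aXb$-path. -}

module Defs where

open import Data.Nat using (ℕ; zero; suc; _+_; _≤_; _<_)
open import Data.Nat.Divisibility using (_∣_)
open import Data.Fin using (Fin; toℕ; fromℕ) renaming (zero to fzero)
open import Data.List using (List; length; filterᵇ; allFin)
open import Data.Bool using (Bool; T; false)
open import Data.Product using (Σ; ∃; ∃-syntax; _×_; _,_)
open import Data.Sum using (_⊎_)
open import Data.Unit using (⊤)
open import Data.Empty using (⊥)
open import Relation.Nullary using (¬_)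
open import Relation.Binary.PropositionalEquality using (_≡_; _≢_)
open import Function.Bundles using (_⇔_)

data Kind : Set where
  theta-free triangle-free wac-free turtle-free c-wac-free
    even-hole-free prism-free even-wheel-free bipartite : Kind

record Graph (n : ℕ) : Set where
  field
    E     : Fin n → Fin n → Bool
    Esym  : ∀ u v → E u v ≡ E v u
    Eirr  : ∀ v → E v v ≡ false

module _ {n : ℕ} (G : Graph n) where
  open Graph G

  Adj : Fin n → Fin n → Set
  Adj u v = T (E u v)

  -- Vertex sets are predicates; G[S] is the subgraph induced by S.
  VSet : Set₁
  VSet = Fin n → Set

  Whole : VSet
  Whole _ = ⊤

  Consec : ℕ → ℕ → Set
  Consec i j = suc i ≡ j ⊎ suc j ≡ i

  record Path : Set where
    field
      len  : ℕ
      vx   : Fin (suc len) → Fin n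
      inj  : ∀ i j → vx i ≡ vx j → i ≡ j
      adjs : ∀ i j → Adj (vx i) (vx j) ⇔ Consec (toℕ i) (toℕ j)

    start : Fin n
    start = vx fzero

    end : Fin n
    end = vx (fromℕ len)

    Internal : Fin (suc len) → Set
    Internal i = 0 < toℕ i × toℕ i < len

  open Path public

  PathIn : VSet → Path → Set
  PathIn S P = ∀ i → S (vx P i)

  IsAZBPath : Fin n → VSet → Fin n → Path → Set
  IsAZBPath a Z b P = start P ≡ a × end P ≡ b × (∀ i → Internal P i → Z (vx P i))

  CycConsec : ℕ → ℕ → ℕ → Set
  CycConsec k i j = suc i ≡ j ⊎ suc j ≡ i ⊎ (i ≡ 0 × suc j ≡ k) ⊎ (j ≡ 0 × suc i ≡ k)

  record Hole : Set where
    field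
      hlen  : ℕ
      hlen≥4 : 4 ≤ hlen
      hv    : Fin hlen → Fin n
      hinj  : ∀ i j → hv i ≡ hv j → i ≡ j
      hadjs : ∀ i j → Adj (hv i) (hv j) ⇔ CycConsec hlen (toℕ i) (toℕ j)

  open Hole public

  HoleIn : VSet → Hole → Set
  HoleIn S H = ∀ i → S (hv H i)

  nbrCount : Fin n → Hole → ℕ
  nbrCount c H = length (filterᵇ (λ i → E c (hv H i)) (allFin (hlen H)))

  IsWheel : Hole → Fin n → Set
  IsWheel H c = (∀ i → hv H i ≢ c) × 3 ≤ nbrCount c H

  CycStep : ℕ → ℕ → ℕ → ℕ → Set
  CycStep k i t j = i + t ≡ j ⊎ i + t ≡ j + k

  IsSector : (H : Hole) → Fin n → Fin (hlen H) → ℕ → Set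
  IsSector H c i l =
    1 ≤ l × l < hlen H ×
    (∀ (j : Fin (hlen H)) t → t ≤ l → CycStep (hlen H) (toℕ i) t (toℕ j) →
       Adj c (hv H j) ⇔ (t ≡ 0 ⊎ t ≡ l))

  InSector : (H : Hole) → Fin (hlen H) → ℕ → Fin (hlen H) → Set
  InSector H i l j = ∃[ t ] (t ≤ l × CycStep (hlen H) (toℕ i) t (toℕ j))

  SectorContains : Hole → Fin n → Fin n → Set
  SectorContains H y x =
    Σ (Fin (hlen H)) λ i → ∃[ l ] (IsSector H y i l ×
      (∀ j → Adj x (hv H j) → InSector H i l j))

  Triangle : VSet → Set
  Triangle S = ∃[ u ] ∃[ v ] ∃[ w ] (S u × S v × S w × Adj u v × Adj v w × Adj u w)

  record Theta (S : VSet) : Set where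
    field
      ta tb   : Fin n
      tnonadj : ¬ Adj ta tb
      tP      : Fin 3 → Path
      tends   : ∀ k → start (tP k) ≡ ta × end (tP k) ≡ tb
      tlen    : ∀ k → 2 ≤ len (tP k)
      tdisj   : ∀ k k' i j → k ≢ k' → Internal (tP k) i → Internal (tP k') j →
                vx (tP k) i ≢ vx (tP k') j
      tnoedge : ∀ k k' i j → k ≢ k' → Internal (tP k) i → Internal (tP k') j →
                ¬ Adj (vx (tP k) i) (vx (tP k') j)
      tin     : ∀ k → PathIn S (tP k)

  record Prism (S : VSet) : Set where
    field
      pP      : Fin 3 → Path
      plen    : ∀ k → 1 ≤ len (pP k)
      pdisj   : ∀ k k' i j → k ≢ k' → vx (pP k) i ≢ vx (pP k') j
      pedges  : ∀ k k' i j → k ≢ k' →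
                Adj (vx (pP k) i) (vx (pP k') j) ⇔
                ((toℕ i ≡ 0 × toℕ j ≡ 0) ⊎ (toℕ i ≡ len (pP k) × toℕ j ≡ len (pP k')))
      pin     : ∀ k → PathIn S (pP k)

  record EvenHole (S : VSet) : Set where
    field
      ehH    : Hole
      eheven : 2 ∣ hlen ehH
      ehin   : HoleIn S ehH

  record EvenWheel (S : VSet) : Set where
    field
      ewH     : Hole
      ewc     : Fin n
      ewwheel : IsWheel ewH ewc
      eweven  : 2 ∣ nbrCount ewc ewH
      ewinH   : HoleIn S ewH
      ewinc   : S ewc

  record Wac (S : VSet) : Set where
    field
      wH     : Hole
      wx wy  : Fin n
      wxy    : Adj wx wy
      wwx    : IsWheel wH wx
      wwy    : IsWheel wH wy
      winH   : HoleIn S wH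
      winx   : S wx
      winy   : S wy

  open Wac public

  IsTurtle : ∀ {S} → Wac S → Set
  IsTurtle w = SectorContains (wH w) (wy w) (wx w) ⊎ SectorContains (wH w) (wx w) (wy w)

  Turtle : VSet → Set
  Turtle S = Σ (Wac S) IsTurtle

  CWac : VSet → Set
  CWac S = Σ (Wac S) λ w → ¬ IsTurtle w

  Bipartite : VSet → Set
  Bipartite S = Σ (Fin n → Bool) λ col → ∀ u v → S u → S v → Adj u v → col u ≢ col v

  Has : Kind → VSet → Set
  Has theta-free      S = ¬ Theta S
  Has triangle-free   S = ¬ Triangle S
  Has wac-free        S = ¬ Wac S
  Has turtle-free     S = ¬ Turtle S
  Has c-wac-free      S = ¬ CWac S
  Has even-hole-free  S = ¬ EvenHole S
  Has prism-free      S = ¬ Prism S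
  Has even-wheel-free S = ¬ EvenWheel S
  Has bipartite       S = Bipartite S

  data Reach (S : VSet) (u : Fin n) : Fin n → Set where
    here : Reach S u u
    step : ∀ {v w} → Reach S u v → S w → Adj v w → Reach S u w

  Connected : VSet → Set
  Connected S = ∀ u v → S u → S v → Reach S u v

  _∪ab : VSet → Fin n → Fin n → VSet
  (Z ∪ab) a b = λ v → Z v ⊎ v ≡ a ⊎ v ≡ b

  IsABPathItself : Fin n → VSet → Fin n → Set
  IsABPathItself a Z b = Σ Path λ P → IsAZBPath a Z b P ×
    (∀ v → Z v → ∃[ i ] (vx P i ≡ v))

  SideOK : Fin n → VSet → Fin n → Set
  SideOK a Z b = (Σ Path (IsAZBPath a Z b)) × ¬ IsABPathItself a Z b

  record ProperTwoSep (a b : Fin n) (X Y : VSet) : Set where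
    field
      a≢b    : a ≢ b
      nonadj : ¬ Adj a b
      cover  : ∀ v → v ≡ a ⊎ v ≡ b ⊎ X v ⊎ Y v
      Xa     : ¬ X a
      Xb     : ¬ X b
      Ya     : ¬ Y a
      Yb     : ¬ Y b
      XY     : ∀ v → X v → Y v → ⊥
      Xne    : ∃[ v ] X v
      Yne    : ∃[ v ] Y v
      Xconn  : Connected X
      Yconn  : Connected Y
      noXY   : ∀ u v → X u → Y v → ¬ Adj u v
      Xok    : SideOK a X b
      Yok    : SideOK a Y b

  BlockSet : VSet → Fin n → Fin n → Path → VSet
  BlockSet Z a b Q = λ v → (Z ∪ab) a b v ⊎ ∃[ i ] (vx Q i ≡ v)

module Submission where

open import Defs
open import Data.Bool using (Bool; true; false; T; not; _∨_; _xor_)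
open import Data.Bool.Properties using (¬-not; not-injective; not-involutive; not-distribˡ-xor; not-distribʳ-xor; xor-assoc; xor-same; xor-identityʳ)
open import Data.Empty
open import Data.Fin using (Fin; toℕ; fromℕ<; fromℕ) renaming (zero to fzero; suc to fsuc)
import Data.Fin.Properties as Fin
open import Data.List using (filterᵇ; tabulate)
import Data.List as List
open import Data.Nat
open import Data.Nat.DivMod
open import Data.Nat.Divisibility using (_∣_; _∣?_; m%n≡0⇒n∣m; ∣m+n∣m⇒∣n)
open import Data.Nat.Properties
open import Algebra.Properties.CommutativeSemigroup +-commutativeSemigroup using (interchange)
open import Data.Product
open import Data.Sum using (_⊎_; inj₁; inj₂; [_,_]′)
import Data.Sum as Sum
open import Data.Unit using (tt)
open import Function.Base using (_∘_; _∘′_; id)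
open import Function.Bundles using (_⇔_; mk⇔; Equivalence)
open import Relation.Binary.Definitions using (tri<; tri≈; tri>)
open import Relation.Binary.PropositionalEquality
open import Relation.Nullary
open import Relation.Nullary.Decidable using (does)

open Equivalence using (to; from)

-- A configuration in a block is one in G, since a block is an induced subgraph of G.
-- Conversely, a hole of G either lies in one side together with {a, b}, or it passes
-- through a and b, running through Z on one arc and through W on the other. No edge
-- joins Z to W, so the W-arc can be exchanged for the aWb-path of the block of Z: the
-- result is again a hole on which every vertex of Z keeps its neighbours, so wheels,
-- the parity of their degrees, wacs and their sectors all survive. If both holes
-- obtained by exchanging one arc are odd although the original hole is even, then the
-- hole formed by the two block paths is even. A theta or a prism is treated one path at
-- a time: a stretch of a path inside W is bounded by a and b, and exchanging it keeps
-- the configuration. Triangles never meet both sides, and 2-colourings of the two blocks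
-- agree on {a, b} up to swapping colours, because both blocks contain the path of the
-- block of Z.

-- Indices beyond N are clamped to N.
clamp : (N : ℕ) → ℕ → Fin (suc N)
clamp N k = fromℕ< (s≤s (m⊓n≤n k N))

toℕ-clamp : ∀ N {k} → k ≤ N → toℕ (clamp N k) ≡ k
toℕ-clamp N k≤N = trans (Fin.toℕ-fromℕ< _) (m≤n⇒m⊓n≡m k≤N)

clamp-toℕ : ∀ N (i : Fin (suc N)) → clamp N (toℕ i) ≡ i
clamp-toℕ N i = Fin.toℕ-injective (toℕ-clamp N (Fin.toℕ≤pred[n] i))

≤⊎> : ∀ m n → m ≤ n ⊎ n < m
≤⊎> m n with m ≤? n
... | yes m≤n = inj₁ m≤n
... | no m≰n = inj₂ (≰⇒> m≰n)

≤⊎+ : ∀ m k → k ≤ m ⊎ ∃[ j ] (0 < j × k ≡ m + j)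
≤⊎+ m k with ≤⊎> k m
... | inj₁ k≤m = inj₁ k≤m
... | inj₂ m<k = inj₂ (k ∸ m , m<n⇒0<n∸m m<k , sym (m+[n∸m]≡n (<⇒≤ m<k)))

module _ (L : ℕ) .{{_ : NonZero L}} where

  %-cong-+ʳ : ∀ {m n} t → m % L ≡ n % L → (m + t) % L ≡ (n + t) % L
  %-cong-+ʳ {m} {n} t eq = begin
    (m + t) % L               ≡⟨ %-distribˡ-+ m t L ⟩
    (m % L + t % L) % L       ≡⟨ cong (λ r → (r + t % L) % L) eq ⟩
    (n % L + t % L) % L       ≡⟨ %-distribˡ-+ n t L ⟨
    (n + t) % L               ∎
    where open ≡-Reasoning

  %-cong-+ˡ : ∀ {m n} t → m % L ≡ n % L → (t + m) % L ≡ (t + n) % L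
  %-cong-+ˡ {m} {n} t eq =
    trans (cong (_% L) (+-comm t m)) (trans (%-cong-+ʳ t eq) (cong (_% L) (+-comm n t)))

  %-absorbˡ : ∀ m t → (m % L + t) % L ≡ (m + t) % L
  %-absorbˡ m t = %-cong-+ʳ t (m%n%n≡m%n m L)

  %-absorbʳ : ∀ t m → (t + m % L) % L ≡ (t + m) % L
  %-absorbʳ t m = %-cong-+ˡ t (m%n%n≡m%n m L)

  %-cancel-+ˡ : ∀ c {m n} → (c + m) % L ≡ (c + n) % L → m % L ≡ n % L
  %-cancel-+ˡ c {m} {n} eq = trans (sym (complement m)) (trans (%-cong-+ˡ d eq) (complement n))
    where
    d = L ∸ c % L
    d+c≡0 : (d + c) % L ≡ 0
    d+c≡0 = begin
      (d + c) % L         ≡⟨ %-absorbʳ d c ⟨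
      (d + c % L) % L     ≡⟨ cong (_% L) (m∸n+n≡m (<⇒≤ (m%n<n c L))) ⟩
      L % L               ≡⟨ n%n≡0 L ⟩
      0                   ∎
      where open ≡-Reasoning
    complement : ∀ k → (d + (c + k)) % L ≡ k % L
    complement k = begin
      (d + (c + k)) % L       ≡⟨ cong (_% L) (+-assoc d c k) ⟨
      (d + c + k) % L         ≡⟨ %-absorbˡ (d + c) k ⟨
      ((d + c) % L + k) % L   ≡⟨ cong (λ r → (r + k) % L) d+c≡0 ⟩
      k % L                   ∎
      where open ≡-Reasoning

module _ {n : ℕ} (G : Graph n) where
  open Graph G

  adj-sym : ∀ {u v} → Adj G u v → Adj G v u
  adj-sym {u} {v} = subst T (Esym u v)

  adj-irrefl : ∀ {u} → ¬ Adj G u u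
  adj-irrefl {u} = subst T (Eirr u)

  CycConsec-sym : ∀ {L i j} → CycConsec G L i j → CycConsec G L j i
  CycConsec-sym (inj₁ e) = inj₂ (inj₁ e)
  CycConsec-sym (inj₂ (inj₁ e)) = inj₁ e
  CycConsec-sym (inj₂ (inj₂ (inj₁ e))) = inj₂ (inj₂ (inj₂ e))
  CycConsec-sym (inj₂ (inj₂ (inj₂ e))) = inj₂ (inj₂ (inj₁ e))

  pAt : Path G → ℕ → Fin n
  pAt R k = vx R (clamp (len R) k)

  module _ (R : Path G) where

    pAt-vx : ∀ i → pAt R (toℕ i) ≡ vx R i
    pAt-vx i = cong (vx R) (clamp-toℕ (len R) i)

    pAt-start : pAt R 0 ≡ start R
    pAt-start = pAt-vx fzero

    pAt-end : pAt R (len R) ≡ end R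
    pAt-end = trans (cong (pAt R) (sym (Fin.toℕ-fromℕ (len R)))) (pAt-vx (fromℕ (len R)))

    pAt-injective : ∀ {k k′} → k ≤ len R → k′ ≤ len R → pAt R k ≡ pAt R k′ → k ≡ k′
    pAt-injective {k} {k′} k≤ k′≤ eq =
      trans (sym (toℕ-clamp _ k≤)) (trans (cong toℕ (inj R _ _ eq)) (toℕ-clamp _ k′≤))

    pAt-consec : ∀ {k k′} → k ≤ len R → k′ ≤ len R → Adj G (pAt R k) (pAt R k′) → Consec G k k′
    pAt-consec k≤ k′≤ uv = subst₂ (Consec G) (toℕ-clamp _ k≤) (toℕ-clamp _ k′≤) (to (adjs R _ _) uv)

    pAt-step : ∀ {k} → k < len R → Adj G (pAt R k) (pAt R (suc k))
    pAt-step {k} k< = from (adjs R _ _) (inj₁ (trans (cong suc (toℕ-clamp _ (<⇒≤ k<))) (sym (toℕ-clamp _ k<))))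

    interior : ∀ {k} → 0 < k → k < len R → Internal R (clamp (len R) k)
    interior {k} 0<k k< = subst (0 <_) (sym k≡) 0<k , subst (_< len R) (sym k≡) k<
      where k≡ = toℕ-clamp (len R) (<⇒≤ k<)

  record PathSpec : Set where
    field
      length  : ℕ
      vertex  : ℕ → Fin n
      injective : ∀ {k k′} → k ≤ length → k′ ≤ length → vertex k ≡ vertex k′ → k ≡ k′
      adj⇒consec : ∀ {k k′} → k ≤ length → k′ ≤ length → Adj G (vertex k) (vertex k′) → Consec G k k′
      adj-suc : ∀ {k} → k < length → Adj G (vertex k) (vertex (suc k))

  module _ (S : PathSpec) where
    open PathSpec S

    mkPath : Path G
    mkPath = record
      { len = length
      ; vx = λ i → vertex (toℕ i)
      ; inj = λ i j eq → Fin.toℕ-injective (injective (Fin.toℕ≤pred[n] i) (Fin.toℕ≤pred[n] j) eq)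
      ; adjs = λ i j → mk⇔ (adj⇒consec (Fin.toℕ≤pred[n] i) (Fin.toℕ≤pred[n] j)) (back (Fin.toℕ≤pred[n] i) (Fin.toℕ≤pred[n] j)) }
      where
      back : ∀ {k k′} → k ≤ length → k′ ≤ length → Consec G k k′ → Adj G (vertex k) (vertex k′)
      back _ k′≤ (inj₁ refl) = adj-suc k′≤
      back k≤ _ (inj₂ refl) = adj-sym (adj-suc k≤)

    mkPath-at : ∀ {k} → k ≤ length → pAt mkPath k ≡ vertex k
    mkPath-at k≤ = cong vertex (toℕ-clamp length k≤)

hlen-nonZero : ∀ {n} {G : Graph n} (H : Hole G) → NonZero (hlen H)
hlen-nonZero H = >-nonZero (≤-trans (s≤s z≤n) (hlen≥4 H))

module _ {n : ℕ} (G : Graph n) where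

  -- Positions on a hole are taken modulo its length.
  hAt : Hole G → ℕ → Fin n
  hAt H k = hv H (fromℕ< (m%n<n k (hlen H) {{hlen-nonZero H}}))

  module _ (H : Hole G) where
    private
      L = hlen H
      instance _ = hlen-nonZero H

    hAt-vx : ∀ i → hAt H (toℕ i) ≡ hv H i
    hAt-vx i = cong (hv H) (Fin.toℕ-injective (trans (Fin.toℕ-fromℕ< _) (m<n⇒m%n≡m (Fin.toℕ<n i))))

    hAt-cong : ∀ {k k′} → k % L ≡ k′ % L → hAt H k ≡ hAt H k′
    hAt-cong eq = cong (hv H) (Fin.toℕ-injective (trans (Fin.toℕ-fromℕ< _) (trans eq (sym (Fin.toℕ-fromℕ< _)))))

    hAt-injective : ∀ {k k′} → hAt H k ≡ hAt H k′ → k % L ≡ k′ % L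
    hAt-injective eq = trans (sym (Fin.toℕ-fromℕ< _)) (trans (cong toℕ (hinj H _ _ eq)) (Fin.toℕ-fromℕ< _))

    hAt-periodic : ∀ k → hAt H (k + L) ≡ hAt H k
    hAt-periodic k = hAt-cong ([m+n]%n≡m%n k L)

    hAt-adj⇒ : ∀ {k k′} → Adj G (hAt H k) (hAt H k′) → CycConsec G L (k % L) (k′ % L)
    hAt-adj⇒ uv = subst₂ (CycConsec G L) (Fin.toℕ-fromℕ< _) (Fin.toℕ-fromℕ< _) (to (hadjs H _ _) uv)

    hAt-adj⇐ : ∀ {k k′} → CycConsec G L (k % L) (k′ % L) → Adj G (hAt H k) (hAt H k′)
    hAt-adj⇐ c = from (hadjs H _ _) (subst₂ (CycConsec G L) (sym (Fin.toℕ-fromℕ< _)) (sym (Fin.toℕ-fromℕ< _)) c)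

    hAt-step : ∀ k → Adj G (hAt H k) (hAt H (suc k))
    hAt-step k = hAt-adj⇐ (next (m≤n⇒m<n∨m≡n (m%n<n k L)))
      where
      suc% : suc k % L ≡ suc (k % L) % L
      suc% = sym (%-absorbʳ L 1 k)
      next : suc (k % L) < L ⊎ suc (k % L) ≡ L → CycConsec G L (k % L) (suc k % L)
      next (inj₁ lt) = inj₁ (sym (trans suc% (m<n⇒m%n≡m lt)))
      next (inj₂ eq) = inj₂ (inj₂ (inj₂ (trans suc% (trans (cong (_% L) eq) (n%n≡0 L)) , eq)))

    hAt-adj : ∀ {k k′} → Adj G (hAt H k) (hAt H k′) → suc k % L ≡ k′ % L ⊎ suc k′ % L ≡ k % L
    hAt-adj {k} {k′} uv =
      Sum.map (trans (sym (%-absorbʳ L 1 k))) (trans (sym (%-absorbʳ L 1 k′)))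
              (cyc-succ (m%n<n k L) (m%n<n k′ L) (hAt-adj⇒ uv))
      where
      cyc-succ : ∀ {i j} → i < L → j < L → CycConsec G L i j → suc i % L ≡ j ⊎ suc j % L ≡ i
      cyc-succ _ j<L (inj₁ refl) = inj₁ (m<n⇒m%n≡m j<L)
      cyc-succ i<L _ (inj₂ (inj₁ refl)) = inj₂ (m<n⇒m%n≡m i<L)
      cyc-succ _ _ (inj₂ (inj₂ (inj₁ (refl , eqL)))) = inj₂ (trans (cong (_% L) eqL) (n%n≡0 L))
      cyc-succ _ _ (inj₂ (inj₂ (inj₂ (refl , eqL)))) = inj₁ (trans (cong (_% L) eqL) (n%n≡0 L))

  record HoleSpec : Set where
    field
      length     : ℕ
      length≥4   : 4 ≤ length
      vertex     : ℕ → Fin n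
      injective  : ∀ {k k′} → k < length → k′ < length → vertex k ≡ vertex k′ → k ≡ k′
      adj⇒consec : ∀ {k k′} → k < length → k′ < length → Adj G (vertex k) (vertex k′) → CycConsec G length k k′
      adj-suc    : ∀ {k} → suc k < length → Adj G (vertex k) (vertex (suc k))
      adj-last   : Adj G (vertex (pred length)) (vertex 0)

  module _ (S : HoleSpec) where
    open HoleSpec S

    mkHole : Hole G
    mkHole = record
      { hlen = length ; hlen≥4 = length≥4 ; hv = λ i → vertex (toℕ i)
      ; hinj = λ i j eq → Fin.toℕ-injective (injective (Fin.toℕ<n i) (Fin.toℕ<n j) eq)
      ; hadjs = λ i j → mk⇔ (adj⇒consec (Fin.toℕ<n i) (Fin.toℕ<n j)) (back (Fin.toℕ<n i) (Fin.toℕ<n j)) }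
      where
      back : ∀ {k k′} → k < length → k′ < length → CycConsec G length k k′ → Adj G (vertex k) (vertex k′)
      back _ k′< (inj₁ refl) = adj-suc k′<
      back k< _ (inj₂ (inj₁ refl)) = adj-sym G (adj-suc k<)
      back _ _ (inj₂ (inj₂ (inj₁ (refl , eqL)))) = subst (λ k → Adj G (vertex 0) (vertex k)) (sym (cong pred eqL)) (adj-sym G adj-last)
      back _ _ (inj₂ (inj₂ (inj₂ (refl , eqL)))) = subst (λ k → Adj G (vertex k) (vertex 0)) (sym (cong pred eqL)) adj-last

    mkHole-at : ∀ k → hAt mkHole k ≡ vertex (_%_ k length {{hlen-nonZero mkHole}})
    mkHole-at k = cong vertex (Fin.toℕ-fromℕ< _)

Consec-∸ : ∀ {N k k′} → k ≤ N → k′ ≤ N → (suc k ≡ k′ ⊎ suc k′ ≡ k) → (suc (N ∸ k) ≡ N ∸ k′ ⊎ suc (N ∸ k′) ≡ N ∸ k)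
Consec-∸ _ k′≤ (inj₁ refl) = inj₂ (sym (+-∸-assoc 1 k′≤))
Consec-∸ k≤ _ (inj₂ refl) = inj₁ (sym (+-∸-assoc 1 k≤))

Consec-+ : ∀ m {k k′} → (suc k ≡ k′ ⊎ suc k′ ≡ k) → (suc (m + k) ≡ m + k′ ⊎ suc (m + k′) ≡ m + k)
Consec-+ m (inj₁ refl) = inj₁ (sym (+-suc m _))
Consec-+ m (inj₂ refl) = inj₂ (sym (+-suc m _))

Consec-+⁻¹ : ∀ m {k k′} → (suc (m + k) ≡ m + k′ ⊎ suc (m + k′) ≡ m + k) → (suc k ≡ k′ ⊎ suc k′ ≡ k)
Consec-+⁻¹ m = Sum.map (λ e → +-cancelˡ-≡ m _ _ (trans (+-suc m _) e)) (λ e → +-cancelˡ-≡ m _ _ (trans (+-suc m _) e))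

module _ {n : ℕ} (G : Graph n) where

  reverse : Path G → Path G
  reverse R = mkPath G record
    { length = L ; vertex = λ k → pAt G R (L ∸ k)
    ; injective = λ {k} {k′} k≤ k′≤ eq → ∸-cancelˡ-≡ k≤ k′≤ (pAt-injective G R (m∸n≤m L k) (m∸n≤m L k′) eq)
    ; adj⇒consec = λ {k} {k′} k≤ k′≤ uv → subst₂ (Consec G) (m∸[m∸n]≡n k≤) (m∸[m∸n]≡n k′≤)
                     (Consec-∸ (m∸n≤m L k) (m∸n≤m L k′) (pAt-consec G R (m∸n≤m L k) (m∸n≤m L k′) uv))
    ; adj-suc = λ {k} k< → adj-sym G (subst (λ i → Adj G (pAt G R (L ∸ suc k)) (pAt G R i)) (sym (+-∸-assoc 1 k<))
                                        (pAt-step G R (subst (_≤ L) (+-∸-assoc 1 k<) (m∸n≤m L k)))) }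
    where L = len R

  pAt-reverse : ∀ R {k} → k ≤ len R → pAt G (reverse R) k ≡ pAt G R (len R ∸ k)
  pAt-reverse R k≤ = cong (λ i → pAt G R (len R ∸ i)) (toℕ-clamp (len R) k≤)

  module _ (H : Hole G) (c m : ℕ) (m+1<L : suc m < hlen H) where
    private
      L = hlen H
      instance _ = hlen-nonZero H
      small : ∀ {k} → k ≤ m → k % L ≡ k
      small k≤m = m<n⇒m%n≡m (≤-trans (s≤s k≤m) (<⇒≤ m+1<L))
      cancel : ∀ {k k′} → k ≤ m → k′ ≤ m → (c + k) % L ≡ (c + k′) % L → k ≡ k′
      cancel k≤m k′≤m eq = trans (sym (small k≤m)) (trans (%-cancel-+ˡ L c eq) (small k′≤m))

    arc : Path G
    arc = mkPath G record
      { length = m ; vertex = λ k → hAt G H (c + k)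
      ; injective = λ k≤ k′≤ eq → cancel k≤ k′≤ (hAt-injective G H eq)
      ; adj⇒consec = consec
      ; adj-suc = λ {k} _ → subst (λ i → Adj G (hAt G H (c + k)) (hAt G H i)) (sym (+-suc c k)) (hAt-step G H (c + k)) }
      where
      succ : ∀ {k k′} → k ≤ m → k′ ≤ m → suc (c + k) % L ≡ (c + k′) % L → suc k ≡ k′
      succ k≤ k′≤ eq = trans (sym (m<n⇒m%n≡m (≤-trans (s≤s (s≤s k≤)) m+1<L)))
                         (trans (%-cancel-+ˡ L c (trans (cong (_% L) (+-suc c _)) eq)) (small k′≤))
      consec : ∀ {k k′} → k ≤ m → k′ ≤ m → Adj G (hAt G H (c + k)) (hAt G H (c + k′)) → Consec G k k′
      consec k≤ k′≤ uv = Sum.map (succ k≤ k′≤) (succ k′≤ k≤) (hAt-adj G H uv)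

    pAt-arc : ∀ {k} → k ≤ m → pAt G arc k ≡ hAt G H (c + k)
    pAt-arc k≤ = cong (λ i → hAt G H (c + i)) (toℕ-clamp m k≤)

  module _ (R : Path G) {p q : ℕ} (p≤q : p ≤ q) (q≤ : q ≤ len R) where
    private
      inside : ∀ {k} → k ≤ q ∸ p → p + k ≤ len R
      inside k≤ = ≤-trans (+-monoʳ-≤ p k≤) (≤-trans (≤-reflexive (m+[n∸m]≡n p≤q)) q≤)

    subpath : Path G
    subpath = mkPath G record
      { length = q ∸ p ; vertex = λ k → pAt G R (p + k)
      ; injective = λ k≤ k′≤ eq → +-cancelˡ-≡ p _ _ (pAt-injective G R (inside k≤) (inside k′≤) eq)
      ; adj⇒consec = λ k≤ k′≤ uv → Consec-+⁻¹ p (pAt-consec G R (inside k≤) (inside k′≤) uv)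
      ; adj-suc = λ {k} k< → subst (λ i → Adj G (pAt G R (p + k)) (pAt G R i)) (sym (+-suc p k))
                                (pAt-step G R (subst (_≤ len R) (+-suc p k) (inside k<))) }

    pAt-subpath : ∀ {k} → k ≤ q ∸ p → pAt G subpath k ≡ pAt G R (p + k)
    pAt-subpath k≤ = cong (λ i → pAt G R (p + i)) (toℕ-clamp (q ∸ p) k≤)

  join : ℕ → (ℕ → Fin n) → (ℕ → Fin n) → ℕ → Fin n
  join l f g k with k ≤? l
  ... | yes _ = f k
  ... | no _ = g (k ∸ l)

  join-left : ∀ l f g {k} → k ≤ l → join l f g k ≡ f k
  join-left l f g {k} k≤l with k ≤? l
  ... | yes _ = refl
  ... | no k≰l = ⊥-elim (k≰l k≤l)

  join-right : ∀ l f g → f l ≡ g 0 → ∀ j → join l f g (l + j) ≡ g j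
  join-right l f g meet zero with l + 0 ≤? l
  ... | yes _ = trans (cong f (+-identityʳ l)) meet
  ... | no l≰l = ⊥-elim (l≰l (≤-reflexive (+-identityʳ l)))
  join-right l f g meet (suc j) with l + suc j ≤? l
  ... | yes l+j≤l = ⊥-elim (<⇒≱ (m<m+n l z<s) l+j≤l)
  ... | no _ = cong g (m+n∸m≡n l (suc j))

  record Concatenable (P₁ P₂ : Path G) : Set where
    field
      meet        : pAt G P₁ (len P₁) ≡ pAt G P₂ 0
      disjoint    : ∀ {k k′} → k < len P₁ → 0 < k′ → k′ ≤ len P₂ → pAt G P₁ k ≢ pAt G P₂ k′
      nonadjacent : ∀ {k k′} → k < len P₁ → 0 < k′ → k′ ≤ len P₂ → ¬ Adj G (pAt G P₁ k) (pAt G P₂ k′)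

  module _ {P₁ P₂ : Path G} (C : Concatenable P₁ P₂) where
    open Concatenable C
    private
      l₁ = len P₁
      l₂ = len P₂
      f = join l₁ (pAt G P₁) (pAt G P₂)
      fˡ : ∀ {k} → k ≤ l₁ → f k ≡ pAt G P₁ k
      fˡ = join-left l₁ (pAt G P₁) (pAt G P₂)
      fʳ : ∀ j → f (l₁ + j) ≡ pAt G P₂ j
      fʳ = join-right l₁ (pAt G P₁) (pAt G P₂) meet
      bound : ∀ {j} → l₁ + j ≤ l₁ + l₂ → j ≤ l₂
      bound = +-cancelˡ-≤ l₁ _ _

      first≢second : ∀ {k j} → k ≤ l₁ → 0 < j → j ≤ l₂ → pAt G P₁ k ≢ pAt G P₂ j
      first≢second k≤ 0<j j≤ eq with m≤n⇒m<n∨m≡n k≤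
      ... | inj₁ k< = disjoint k< 0<j j≤ eq
      ... | inj₂ refl = <⇒≢ 0<j (pAt-injective G P₂ z≤n j≤ (trans (sym meet) eq))

      first-adj-second : ∀ {k j} → k ≤ l₁ → 0 < j → j ≤ l₂ → Adj G (pAt G P₁ k) (pAt G P₂ j) → Consec G k (l₁ + j)
      first-adj-second k≤ 0<j j≤ uv with m≤n⇒m<n∨m≡n k≤
      ... | inj₁ k< = ⊥-elim (nonadjacent k< 0<j j≤ uv)
      ... | inj₂ refl with pAt-consec G P₂ z≤n j≤ (subst (λ u → Adj G u _) meet uv)
      ...   | inj₁ refl = inj₁ (+-comm 1 l₁)

      injective : ∀ {k k′} → k ≤ l₁ + l₂ → k′ ≤ l₁ + l₂ → f k ≡ f k′ → k ≡ k′
      injective {k} {k′} k≤ k′≤ eq with ≤⊎+ l₁ k | ≤⊎+ l₁ k′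
      ... | inj₁ i≤ | inj₁ i′≤ = pAt-injective G P₁ i≤ i′≤ (trans (sym (fˡ i≤)) (trans eq (fˡ i′≤)))
      ... | inj₁ i≤ | inj₂ (j′ , 0<j′ , refl) =
            ⊥-elim (first≢second i≤ 0<j′ (bound k′≤) (trans (sym (fˡ i≤)) (trans eq (fʳ j′))))
      ... | inj₂ (j , 0<j , refl) | inj₁ i′≤ =
            ⊥-elim (first≢second i′≤ 0<j (bound k≤) (trans (sym (fˡ i′≤)) (trans (sym eq) (fʳ j))))
      ... | inj₂ (j , _ , refl) | inj₂ (j′ , _ , refl) =
            cong (l₁ +_) (pAt-injective G P₂ (bound k≤) (bound k′≤) (trans (sym (fʳ j)) (trans eq (fʳ j′))))

      adj⇒consec : ∀ {k k′} → k ≤ l₁ + l₂ → k′ ≤ l₁ + l₂ → Adj G (f k) (f k′) → Consec G k k′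
      adj⇒consec {k} {k′} k≤ k′≤ uv with ≤⊎+ l₁ k | ≤⊎+ l₁ k′
      ... | inj₁ i≤ | inj₁ i′≤ = pAt-consec G P₁ i≤ i′≤ (subst₂ (Adj G) (fˡ i≤) (fˡ i′≤) uv)
      ... | inj₁ i≤ | inj₂ (j′ , 0<j′ , refl) = first-adj-second i≤ 0<j′ (bound k′≤) (subst₂ (Adj G) (fˡ i≤) (fʳ j′) uv)
      ... | inj₂ (j , 0<j , refl) | inj₁ i′≤ =
            Sum.swap (first-adj-second i′≤ 0<j (bound k≤) (subst₂ (Adj G) (fˡ i′≤) (fʳ j) (adj-sym G uv)))
      ... | inj₂ (j , _ , refl) | inj₂ (j′ , _ , refl) =
            Consec-+ l₁ (pAt-consec G P₂ (bound k≤) (bound k′≤) (subst₂ (Adj G) (fʳ j) (fʳ j′) uv))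

      adj-suc : ∀ {k} → k < l₁ + l₂ → Adj G (f k) (f (suc k))
      adj-suc {k} k< with ≤⊎+ l₁ (suc k)
      ... | inj₁ k<l₁ = subst₂ (Adj G) (sym (fˡ (<⇒≤ k<l₁))) (sym (fˡ k<l₁)) (pAt-step G P₁ k<l₁)
      ... | inj₂ (suc j , _ , eq) =
            subst₂ (Adj G) (sym (trans (cong f (cong pred (trans eq (+-suc l₁ j)))) (fʳ j)))
                           (sym (trans (cong f eq) (fʳ (suc j))))
                           (pAt-step G P₂ (bound (subst (_≤ l₁ + l₂) eq k<)))

      spec : PathSpec G
      spec = record { length = l₁ + l₂ ; vertex = f ; injective = injective ; adj⇒consec = adj⇒consec ; adj-suc = adj-suc }

    concat : Path G
    concat = mkPath G spec

    pAt-concatˡ : ∀ {k} → k ≤ l₁ → pAt G concat k ≡ pAt G P₁ k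
    pAt-concatˡ k≤ = trans (mkPath-at G spec (≤-trans k≤ (m≤m+n l₁ l₂))) (fˡ k≤)

    pAt-concatʳ : ∀ {j} → j ≤ l₂ → pAt G concat (l₁ + j) ≡ pAt G P₂ j
    pAt-concatʳ {j} j≤ = trans (mkPath-at G spec (+-monoʳ-≤ l₁ j≤)) (fʳ j)

  record Gluable (A B : Path G) : Set where
    field
      A-long      : 2 ≤ len A
      B-long      : 2 ≤ len B
      meet₁       : pAt G A (len A) ≡ pAt G B 0
      meet₂       : pAt G B (len B) ≡ pAt G A 0
      disjoint    : ∀ {k k′} → 0 < k → k < len A → 0 < k′ → k′ < len B → pAt G A k ≢ pAt G B k′
      nonadjacent : ∀ {k k′} → 0 < k → k < len A → 0 < k′ → k′ < len B → ¬ Adj G (pAt G A k) (pAt G B k′)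

  module _ {A B : Path G} (Γ : Gluable A B) where
    open Gluable Γ
    private
      la = len A
      lb = len B
      L = la + lb
      f = join la (pAt G A) (pAt G B)
      fˡ : ∀ {k} → k ≤ la → f k ≡ pAt G A k
      fˡ = join-left la (pAt G A) (pAt G B)
      fʳ : ∀ j → f (la + j) ≡ pAt G B j
      fʳ = join-right la (pAt G A) (pAt G B) meet₁
      bound : ∀ {j} → la + j < L → j < lb
      bound = +-cancelˡ-< la _ _

      A≢B : ∀ {k j} → k ≤ la → 0 < j → j < lb → pAt G A k ≢ pAt G B j
      A≢B {zero} _ _ j< eq = <⇒≢ j< (pAt-injective G B (<⇒≤ j<) ≤-refl (trans (sym eq) (sym meet₂)))
      A≢B {suc k} k≤ 0<j j< eq with m≤n⇒m<n∨m≡n k≤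
      ... | inj₁ k< = disjoint z<s k< 0<j j< eq
      ... | inj₂ refl = <⇒≢ 0<j (sym (pAt-injective G B (<⇒≤ j<) z≤n (trans (sym eq) meet₁)))

      A-adj-B : ∀ {k j} → k ≤ la → 0 < j → j < lb → Adj G (pAt G A k) (pAt G B j) → CycConsec G L k (la + j)
      A-adj-B {zero} {j} _ _ j< uv with pAt-consec G B ≤-refl (<⇒≤ j<) (subst (λ u → Adj G u (pAt G B j)) (sym meet₂) uv)
      ... | inj₁ eq = ⊥-elim (<⇒≱ j< (≤-trans (n≤1+n _) (≤-reflexive eq)))
      ... | inj₂ eq = inj₂ (inj₂ (inj₁ (refl , trans (sym (+-suc la j)) (cong (la +_) eq))))
      A-adj-B {suc k} {j} k≤ 0<j j< uv with m≤n⇒m<n∨m≡n k≤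
      ... | inj₁ k< = ⊥-elim (nonadjacent z<s k< 0<j j< uv)
      ... | inj₂ refl with pAt-consec G B z≤n (<⇒≤ j<) (subst (λ u → Adj G u (pAt G B j)) meet₁ uv)
      ...   | inj₁ refl = inj₁ (+-comm 1 la)

      injective : ∀ {k k′} → k < L → k′ < L → f k ≡ f k′ → k ≡ k′
      injective {k} {k′} k< k′< eq with ≤⊎+ la k | ≤⊎+ la k′
      ... | inj₁ i≤ | inj₁ i′≤ = pAt-injective G A i≤ i′≤ (trans (sym (fˡ i≤)) (trans eq (fˡ i′≤)))
      ... | inj₁ i≤ | inj₂ (j′ , 0<j′ , refl) = ⊥-elim (A≢B i≤ 0<j′ (bound k′<) (trans (sym (fˡ i≤)) (trans eq (fʳ j′))))
      ... | inj₂ (j , 0<j , refl) | inj₁ i′≤ = ⊥-elim (A≢B i′≤ 0<j (bound k<) (trans (sym (fˡ i′≤)) (trans (sym eq) (fʳ j))))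
      ... | inj₂ (j , _ , refl) | inj₂ (j′ , _ , refl) =
            cong (la +_) (pAt-injective G B (<⇒≤ (bound k<)) (<⇒≤ (bound k′<)) (trans (sym (fʳ j)) (trans eq (fʳ j′))))

      adj⇒consec : ∀ {k k′} → k < L → k′ < L → Adj G (f k) (f k′) → CycConsec G L k k′
      adj⇒consec {k} {k′} k< k′< uv with ≤⊎+ la k | ≤⊎+ la k′
      ... | inj₁ i≤ | inj₁ i′≤ = Sum.map₂ inj₁ (pAt-consec G A i≤ i′≤ (subst₂ (Adj G) (fˡ i≤) (fˡ i′≤) uv))
      ... | inj₁ i≤ | inj₂ (j′ , 0<j′ , refl) = A-adj-B i≤ 0<j′ (bound k′<) (subst₂ (Adj G) (fˡ i≤) (fʳ j′) uv)
      ... | inj₂ (j , 0<j , refl) | inj₁ i′≤ =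
            CycConsec-sym G (A-adj-B i′≤ 0<j (bound k<) (subst₂ (Adj G) (fˡ i′≤) (fʳ j) (adj-sym G uv)))
      ... | inj₂ (j , _ , refl) | inj₂ (j′ , _ , refl) = Sum.map₂ inj₁
            (Consec-+ la (pAt-consec G B (<⇒≤ (bound k<)) (<⇒≤ (bound k′<)) (subst₂ (Adj G) (fʳ j) (fʳ j′) uv)))

      adj-suc : ∀ {k} → suc k < L → Adj G (f k) (f (suc k))
      adj-suc {k} k+1< with ≤⊎+ la (suc k)
      ... | inj₁ k<la = subst₂ (Adj G) (sym (fˡ (<⇒≤ k<la))) (sym (fˡ k<la)) (pAt-step G A k<la)
      ... | inj₂ (suc j , _ , eq) =
            subst₂ (Adj G) (sym (trans (cong f (cong pred (trans eq (+-suc la j)))) (fʳ j)))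
                           (sym (trans (cong f eq) (fʳ (suc j))))
                           (pAt-step G B (<⇒≤ (bound (subst (_< L) eq k+1<))))

      adj-last : Adj G (f (pred L)) (f 0)
      adj-last = subst₂ (Adj G) (sym (trans (cong f last) (fʳ (pred lb)))) (sym (trans (fˡ z≤n) (sym meet₂)))
                   (subst (λ i → Adj G (pAt G B (pred lb)) (pAt G B i)) lb≡ (pAt-step G B (≤-reflexive lb≡)))
        where
        lb≡ : suc (pred lb) ≡ lb
        lb≡ = suc-pred lb {{>-nonZero (≤-trans (s≤s z≤n) B-long)}}
        last : pred L ≡ la + pred lb
        last = cong pred (trans (cong (la +_) (sym lb≡)) (+-suc la (pred lb)))

      spec : HoleSpec G
      spec = record
        { length = L ; length≥4 = +-mono-≤ A-long B-long ; vertex = f ; injective = injective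
        ; adj⇒consec = adj⇒consec ; adj-suc = adj-suc ; adj-last = adj-last }
      instance _ = hlen-nonZero (mkHole G spec)

    glue : Hole G
    glue = mkHole G spec

    hAt-glueˡ : ∀ {k} → k ≤ la → hAt G glue k ≡ pAt G A k
    hAt-glueˡ k≤ = trans (mkHole-at G spec _) (trans (cong f (m<n⇒m%n≡m (≤-<-trans k≤ la<L))) (fˡ k≤))
      where la<L = m<m+n la (≤-trans (s≤s z≤n) B-long)

    hAt-glueʳ : ∀ {j} → j < lb → hAt G glue (la + j) ≡ pAt G B j
    hAt-glueʳ {j} j< = trans (mkHole-at G spec _) (trans (cong f (m<n⇒m%n≡m (+-monoʳ-< la j<))) (fʳ j))

-- Separations

module _ {n : ℕ} (G : Graph n) where

  InSep : Fin n → Fin n → Fin n → Set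
  InSep a b v = v ≡ a ⊎ v ≡ b

  InSep? : ∀ a b v → Dec (InSep a b v)
  InSep? a b v with v Fin.≟ a | v Fin.≟ b
  ... | yes v≡a | _ = yes (inj₁ v≡a)
  ... | no _ | yes v≡b = yes (inj₂ v≡b)
  ... | no v≢a | no v≢b = no [ v≢a , v≢b ]′

  module _ {a b : Fin n} where

    InSep-third : ∀ {u v w} → InSep a b u → InSep a b v → u ≢ v → InSep a b w → w ≡ u ⊎ w ≡ v
    InSep-third (inj₁ refl) (inj₁ refl) u≢v _ = ⊥-elim (u≢v refl)
    InSep-third (inj₁ refl) (inj₂ refl) _ (inj₁ refl) = inj₁ refl
    InSep-third (inj₁ refl) (inj₂ refl) _ (inj₂ refl) = inj₂ refl
    InSep-third (inj₂ refl) (inj₁ refl) _ (inj₁ refl) = inj₂ refl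
    InSep-third (inj₂ refl) (inj₁ refl) _ (inj₂ refl) = inj₁ refl
    InSep-third (inj₂ refl) (inj₂ refl) u≢v _ = ⊥-elim (u≢v refl)

    InSep-ends : ∀ {u v} → InSep a b u → InSep a b v → u ≢ v → (u ≡ a × v ≡ b) ⊎ (u ≡ b × v ≡ a)
    InSep-ends (inj₁ refl) (inj₁ refl) u≢v = ⊥-elim (u≢v refl)
    InSep-ends (inj₁ u≡a) (inj₂ v≡b) _ = inj₁ (u≡a , v≡b)
    InSep-ends (inj₂ u≡b) (inj₁ v≡a) _ = inj₂ (u≡b , v≡a)
    InSep-ends (inj₂ refl) (inj₂ refl) u≢v = ⊥-elim (u≢v refl)

  record Separation (a b : Fin n) (Z W : VSet G) : Set where
    field
      a≢b      : a ≢ b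
      a≁b      : ¬ Adj G a b
      cover    : ∀ v → v ≡ a ⊎ v ≡ b ⊎ Z v ⊎ W v
      a∉Z      : ¬ Z a
      b∉Z      : ¬ Z b
      a∉W      : ¬ W a
      b∉W      : ¬ W b
      disjoint : ∀ {v} → Z v → W v → ⊥
      Z≁W      : ∀ {u v} → Z u → W v → ¬ Adj G u v

  swapSep : ∀ {a b Z W} → Separation a b Z W → Separation a b W Z
  swapSep S = record
    { a≢b = a≢b ; a≁b = a≁b
    ; cover = λ v → Sum.map₂ (Sum.map₂ Sum.swap) (cover v)
    ; a∉Z = a∉W ; b∉Z = b∉W ; a∉W = a∉Z ; b∉W = b∉Z
    ; disjoint = λ w z → disjoint z w
    ; Z≁W = λ w z uv → Z≁W z w (adj-sym G uv) }
    where open Separation S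

  module _ {a b Z W} (S : Separation a b Z W) where
    open Separation S

    InSep-nonadj : ∀ {u v} → InSep a b u → InSep a b v → u ≢ v → ¬ Adj G u v
    InSep-nonadj (inj₁ refl) (inj₁ refl) u≢v _ = u≢v refl
    InSep-nonadj (inj₁ refl) (inj₂ refl) _ uv = a≁b uv
    InSep-nonadj (inj₂ refl) (inj₁ refl) _ uv = a≁b (adj-sym G uv)
    InSep-nonadj (inj₂ refl) (inj₂ refl) u≢v _ = u≢v refl

    Z⊎W : ∀ {v} → ¬ InSep a b v → Z v ⊎ W v
    Z⊎W {v} v∉ with cover v
    ... | inj₁ v≡a = ⊥-elim (v∉ (inj₁ v≡a))
    ... | inj₂ (inj₁ v≡b) = ⊥-elim (v∉ (inj₂ v≡b))
    ... | inj₂ (inj₂ side) = side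

  module Side {a b Z W} (S : Separation a b Z W) where
    open Separation S

    ∉sep : ∀ {v} → Z v → ¬ InSep a b v
    ∉sep z (inj₁ refl) = a∉Z z
    ∉sep z (inj₂ refl) = b∉Z z

    dec : ∀ v → Dec (Z v)
    dec v with cover v
    ... | inj₁ refl = no a∉Z
    ... | inj₂ (inj₁ refl) = no b∉Z
    ... | inj₂ (inj₂ (inj₁ z)) = yes z
    ... | inj₂ (inj₂ (inj₂ w)) = no (λ z → disjoint z w)

    other : ∀ {v} → ¬ Z v → ¬ InSep a b v → W v
    other z∉ v∉ with Z⊎W S v∉
    ... | inj₁ z = ⊥-elim (z∉ z)
    ... | inj₂ w = w

    nbr : ∀ {u v} → Z u → Adj G u v → Z v ⊎ InSep a b v
    nbr {v = v} zu uv with InSep? a b v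
    ... | yes v∈ = inj₂ v∈
    ... | no v∉ with Z⊎W S v∉
    ...   | inj₁ zv = inj₁ zv
    ...   | inj₂ wv = ⊥-elim (Z≁W zu wv uv)

    exit : ∀ {u v} → ¬ Z u → Z v → Adj G u v → InSep a b u
    exit z∉ zv uv with nbr zv (adj-sym G uv)
    ... | inj₁ zu = ⊥-elim (z∉ zu)
    ... | inj₂ u∈ = u∈

    exit-before : (f : ℕ → Fin n) → ∀ k → Z (f k) → ¬ Z (f 0) → (∀ {l} → l < k → Adj G (f l) (f (suc l)))
                → ∃[ i ] (i < k × InSep a b (f i) × (∀ {l} → i < l → l ≤ k → Z (f l)))
    exit-before f zero zk z∉ _ = ⊥-elim (z∉ zk)
    exit-before f (suc k) zk z∉ adj with dec (f k)
    ... | no z∉k = k , ≤-refl , exit z∉k zk (adj ≤-refl) , λ i<l l≤ → subst (λ j → Z (f j)) (≤-antisym i<l l≤) zk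
    ... | yes zk′ with exit-before f k zk′ z∉ (λ l< → adj (m≤n⇒m≤1+n l<))
    ...   | i , i<k , i∈ , inside = i , m≤n⇒m≤1+n i<k , i∈ , λ i<l l≤ →
              [ (λ l<k+1 → inside i<l (≤-pred l<k+1)) , (λ l≡ → subst (λ j → Z (f j)) (sym l≡) zk) ]′ (m≤n⇒m<n∨m≡n l≤)

    exit-after : (f : ℕ → Fin n) → ∀ d k → Z (f k) → ¬ Z (f (k + d)) → (∀ {l} → l < k + d → Adj G (f l) (f (suc l)))
               → ∃[ j ] (k < j × j ≤ k + d × InSep a b (f j) × (∀ {l} → k ≤ l → l < j → Z (f l)))
    exit-after f zero k zk z∉ _ = ⊥-elim (z∉ (subst (λ j → Z (f j)) (sym (+-identityʳ k)) zk))
    exit-after f (suc d) k zk z∉ adj with dec (f (suc k))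
    ... | no z∉k = suc k , ≤-refl , k<k+d+1 ,
                   exit z∉k zk (adj-sym G (adj k<k+d+1)) ,
                   λ k≤l l<k+1 → subst (λ j → Z (f j)) (≤-antisym k≤l (≤-pred l<k+1)) zk
      where
      k<k+d+1 : k < k + suc d
      k<k+d+1 = m<m+n k z<s
    ... | yes zk′ with exit-after f d (suc k) zk′ (subst (λ j → ¬ Z (f j)) (+-suc k d) z∉)
                                (λ {l} l< → adj (subst (l <_) (sym (+-suc k d)) l<))
    ...   | j , k+1<j , j≤ , j∈ , inside = j , <-trans ≤-refl k+1<j , subst (j ≤_) (sym (+-suc k d)) j≤ , j∈ ,
              λ k≤l l<j → [ (λ k<l → inside k<l l<j) , (λ k≡l → subst (λ i → Z (f i)) k≡l zk) ]′ (m≤n⇒m<n∨m≡n k≤l)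

    within : ∀ {v} → ¬ W v → _∪ab G Z a b v
    within {v} w∉ with cover v
    ... | inj₁ v≡a = inj₂ (inj₁ v≡a)
    ... | inj₂ (inj₁ v≡b) = inj₂ (inj₂ v≡b)
    ... | inj₂ (inj₂ (inj₁ z)) = inj₁ z
    ... | inj₂ (inj₂ (inj₂ w)) = ⊥-elim (w∉ w)

-- Holes crossing a separator

module _ {n : ℕ} (G : Graph n) (H : Hole G) where
  private
    L = hlen H
    instance _ = hlen-nonZero H

  hAt-offset : ∀ c i → ∃[ k ] (k < L × hAt G H (c + k) ≡ hv H i)
  hAt-offset c i = k , m%n<n _ L , trans (hAt-cong G H same) (hAt-vx G H i)
    where
    k = (toℕ i + (L ∸ c % L)) % L
    shifted : c % L + (toℕ i + (L ∸ c % L)) ≡ toℕ i + L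
    shifted = begin
      c % L + (toℕ i + (L ∸ c % L))   ≡⟨ cong (c % L +_) (+-comm (toℕ i) _) ⟩
      c % L + ((L ∸ c % L) + toℕ i)   ≡⟨ +-assoc (c % L) _ (toℕ i) ⟨
      c % L + (L ∸ c % L) + toℕ i     ≡⟨ cong (_+ toℕ i) (m+[n∸m]≡n (<⇒≤ (m%n<n c L))) ⟩
      L + toℕ i                       ≡⟨ +-comm L (toℕ i) ⟩
      toℕ i + L                       ∎
      where open ≡-Reasoning
    same : (c + k) % L ≡ toℕ i % L
    same = begin
      (c + k) % L                          ≡⟨ %-absorbʳ L c _ ⟩
      (c + (toℕ i + (L ∸ c % L))) % L     ≡⟨ %-absorbˡ L c _ ⟨
      (c % L + (toℕ i + (L ∸ c % L))) % L ≡⟨ cong (_% L) shifted ⟩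
      (toℕ i + L) % L                      ≡⟨ [m+n]%n≡m%n (toℕ i) L ⟩
      toℕ i % L                            ∎
      where open ≡-Reasoning

  hAt-offset-injective : ∀ c {k k′} → k < L → k′ < L → hAt G H (c + k) ≡ hAt G H (c + k′) → k ≡ k′
  hAt-offset-injective c k< k′< eq =
    trans (sym (m<n⇒m%n≡m k<)) (trans (%-cancel-+ˡ L c (hAt-injective G H eq)) (m<n⇒m%n≡m k′<))

  hAt-offset-step : ∀ c k → Adj G (hAt G H (c + k)) (hAt G H (c + suc k))
  hAt-offset-step c k = subst (λ i → Adj G (hAt G H (c + k)) (hAt G H i)) (sym (+-suc c k)) (hAt-step G H (c + k))

  hAt-offset-wrap : ∀ c {k} → L ≤ k → hAt G H (c + k) ≡ hAt G H (c + (k ∸ L))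
  hAt-offset-wrap c {k} L≤k = trans (cong (hAt G H) (trans (cong (c +_) (sym (m∸n+n≡m L≤k))) (sym (+-assoc c _ L))))
                                    (hAt-periodic G H (c + (k ∸ L)))

+-rearrange : ∀ c m j l → c + m + (l + j) ≡ c + j + (m + l)
+-rearrange c m j l = trans (cong (c + m +_) (+-comm l j)) (interchange c m j l)

module _ {n : ℕ} (G : Graph n) where

  record Crossing (H : Hole G) (a b : Fin n) (Z W : VSet G) : Set where
    field
      c m   : ℕ
      ends  : (hAt G H c ≡ a × hAt G H (c + m) ≡ b) ⊎ (hAt G H c ≡ b × hAt G H (c + m) ≡ a)
      m≥2   : 2 ≤ m
      m+1<L : suc m < hlen H
      inZ   : ∀ {k} → 0 < k → k < m → Z (hAt G H (c + k))
      inW   : ∀ {k} → m < k → k < hlen H → W (hAt G H (c + k))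

    m≤L : m ≤ hlen H
    m≤L = <⇒≤ (<-trans ≤-refl m+1<L)

    start∈ : InSep G a b (hAt G H c)
    start∈ = [ (λ e → inj₁ (proj₁ e)) , (λ e → inj₂ (proj₁ e)) ]′ ends

    end∈ : InSep G a b (hAt G H (c + m))
    end∈ = [ (λ e → inj₂ (proj₂ e)) , (λ e → inj₁ (proj₂ e)) ]′ ends

    start≢end : hAt G H c ≢ hAt G H (c + m)
    start≢end e = <⇒≢ (<-trans z<s m≥2) (hAt-offset-injective G H c (≤-trans (s≤s z≤n) (hlen≥4 H)) (<-trans ≤-refl m+1<L)
                                            (trans (cong (hAt G H) (+-identityʳ c)) e))

  swapCrossing : ∀ {H a b Z W} → Crossing H a b W Z → Crossing H a b Z W
  swapCrossing {H} {a} {b} {Z} {W} X = record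
    { c = c + m ; m = L ∸ m ; ends = Sum.swap (Sum.map (back-to-start ∘′ swap) (back-to-start ∘′ swap) ends)
    ; m≥2 = subst (_≤ L ∸ m) (m+n∸n≡m 2 m) (∸-monoˡ-≤ m m+1<L)
    ; m+1<L = ≤-trans (+-monoʳ-≤ 2 (∸-monoʳ-≤ L m≥2)) (≤-reflexive (m+[n∸m]≡n (≤-trans m≥2 m≤L)))
    ; inZ = inZ′ ; inW = inW′ }
    where
    open Crossing X
    L = hlen H
    around : c + m + (L ∸ m) ≡ c + L
    around = trans (+-assoc c m _) (cong (c +_) (m+[n∸m]≡n m≤L))
    back-to-start : ∀ {u v} → hAt G H (c + m) ≡ u × hAt G H c ≡ v → hAt G H (c + m) ≡ u × hAt G H (c + m + (L ∸ m)) ≡ v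
    back-to-start (e₁ , e₂) = e₁ , trans (cong (hAt G H) around) (trans (hAt-periodic G H c) e₂)
    inZ′ : ∀ {k} → 0 < k → k < L ∸ m → Z (hAt G H (c + m + k))
    inZ′ {k} 0<k k< = subst Z (cong (hAt G H) (sym (+-assoc c m k)))
                        (inW (subst (_≤ m + k) (+-comm m 1) (+-monoʳ-≤ m 0<k))
                             (subst (m + k <_) (m+[n∸m]≡n m≤L) (+-monoʳ-< m k<)))
    inW′ : ∀ {k} → L ∸ m < k → k < L → W (hAt G H (c + m + k))
    inW′ {k} L-m<k k<L with ≤⊎+ (L ∸ m) k
    ... | inj₁ k≤ = ⊥-elim (<⇒≱ L-m<k k≤)
    ... | inj₂ (j , 0<j , refl) =
          subst W (sym (trans (cong (hAt G H) (trans (+-rearrange c m j (L ∸ m)) (cong (c + j +_) (m+[n∸m]≡n m≤L)))) (hAt-periodic G H (c + j))))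
                (inZ 0<j (+-cancelˡ-< (L ∸ m) j m (subst (L ∸ m + j <_) (sym (m∸n+n≡m m≤L)) k<L)))

  module _ {a b Z W} (S : Separation G a b Z W) (H : Hole G) where
    open Separation S
    private
      L = hlen H
      instance _ = hlen-nonZero H
      module Z = Side G S
      module W = Side G (swapSep G S)
      0<L : 0 < L
      0<L = ≤-trans (s≤s z≤n) (hlen≥4 H)

    InSep-offsets : ∀ c {m j} → 0 < m → m < L → j < L → InSep G a b (hAt G H (c + 0)) → InSep G a b (hAt G H (c + m))
                  → InSep G a b (hAt G H (c + j)) → j ≡ 0 ⊎ j ≡ m
    InSep-offsets c 0<m m<L j<L s₀ sₘ sⱼ = Sum.map (hAt-offset-injective G H c j<L 0<L) (hAt-offset-injective G H c j<L m<L)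
      (InSep-third G s₀ sₘ (λ e → <⇒≢ 0<m (hAt-offset-injective G H c 0<L m<L e)) sⱼ)

    sep-after : ∀ c {s t} → s ≤ t → Z (hAt G H (c + s)) → ¬ Z (hAt G H (c + t))
              → ∃[ j ] (s < j × j ≤ t × InSep G a b (hAt G H (c + j)) × (∀ {k} → s ≤ k → k < j → Z (hAt G H (c + k))))
    sep-after c {s} {t} s≤t zₛ z∉ₜ with Z.exit-after (λ k → hAt G H (c + k)) (t ∸ s) s zₛ
                                          (subst (λ k → ¬ Z (hAt G H (c + k))) (sym (m+[n∸m]≡n s≤t)) z∉ₜ)
                                          (λ {l} _ → hAt-offset-step G H c l)
    ... | j , s<j , j≤ , sⱼ , zone = j , s<j , subst (j ≤_) (m+[n∸m]≡n s≤t) j≤ , sⱼ , zone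

  module _ {a b Z W} (S : Separation G a b Z W) (H : Hole G) where
    open Separation S
    private
      L = hlen H
      module Z = Side G S
      module W = Side G (swapSep G S)
      0<L : 0 < L
      0<L = ≤-trans (s≤s z≤n) (hlen≥4 H)

    module _ (c m : ℕ) (1<m : 1 < m) (m<L : m < L) (s₀ : InSep G a b (hAt G H (c + 0)))
             (sₘ : InSep G a b (hAt G H (c + m))) where
      private
        f : ℕ → Fin n
        f k = hAt G H (c + k)
        0<m = <-trans z<s 1<m
        f₀ : f 0 ≡ hAt G H c
        f₀ = cong (hAt G H) (+-identityʳ c)
        f₀≢fₘ : f 0 ≢ f m
        f₀≢fₘ e = <⇒≢ 0<m (hAt-offset-injective G H c 0<L m<L e)

        f-L : f L ≡ f 0
        f-L = trans (hAt-periodic G H c) (sym f₀)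

        m+1<L : suc m < L
        m+1<L with m≤n⇒m<n∨m≡n m<L
        ... | inj₁ lt = lt
        ... | inj₂ m+1≡L = ⊥-elim (InSep-nonadj G S sₘ s₀ (f₀≢fₘ ∘ sym)
                                (subst (Adj G (f m)) (trans (cong f m+1≡L) f-L) (hAt-offset-step G H c m)))

        beyond∉ : ∀ {j} → m < j → j < L → ¬ InSep G a b (f j)
        beyond∉ m<j j<L sⱼ = [ (λ j≡0 → <⇒≢ (≤-<-trans z≤n m<j) (sym j≡0)) , (λ j≡m → <⇒≢ m<j (sym j≡m)) ]′
                              (InSep-offsets S H c 0<m m<L j<L s₀ sₘ sⱼ)

        beyond-W : ∀ {t} → m < t → t < L → W (f t) → W (f (suc m))
        beyond-W {t} m<t t<L wₜ with Z.dec (f (suc m))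
        ... | no z∉ = Z.other z∉ (beyond∉ ≤-refl m+1<L)
        ... | yes z with sep-after S H c m<t z (λ z′ → disjoint z′ wₜ)
        ...   | j , m+1<j , j≤t , sⱼ , _ = ⊥-elim (beyond∉ (<-trans ≤-refl m+1<j) (≤-<-trans j≤t t<L) sⱼ)

        beyond-all-W : W (f (suc m)) → ∀ {k} → m < k → k < L → W (f k)
        beyond-all-W w₁ {k} m<k k<L with sep-after (swapSep G S) H c (<⇒≤ m+1<L) w₁ (λ w → W.∉sep (subst W f-L w) s₀)
        ... | j , m+1<j , j≤L , sⱼ , zone with m≤n⇒m<n∨m≡n j≤L
        ...   | inj₁ j<L = ⊥-elim (beyond∉ (<-trans ≤-refl m+1<j) j<L sⱼ)
        ...   | inj₂ refl = zone m<k k<L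

        beyond : (∀ {k} → 0 < k → k < m → Z (f k)) → ∀ {t} → W (f t) → m < t
        beyond zone {zero} w = ⊥-elim (W.∉sep w s₀)
        beyond zone {suc t} w with <-cmp m (suc t)
        ... | tri< lt _ _ = lt
        ... | tri≈ _ refl _ = ⊥-elim (W.∉sep w sₘ)
        ... | tri> _ _ t<m = ⊥-elim (disjoint (zone z<s t<m) w)

      crossing-between : (∀ {k} → 0 < k → k < m → Z (f k)) → ∀ {t} → t < L → W (f t) → Crossing H a b Z W
      crossing-between zone t<L wₜ = record
        { c = c ; m = m ; ends = ends ; m≥2 = 1<m ; m+1<L = m+1<L ; inZ = zone
        ; inW = beyond-all-W (beyond-W (beyond zone wₜ) t<L wₜ) }
        where
        ends : (hAt G H c ≡ a × f m ≡ b) ⊎ (hAt G H c ≡ b × f m ≡ a)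
        ends = InSep-ends G (subst (InSep G a b) f₀ s₀) sₘ (λ e → f₀≢fₘ (trans f₀ e))

    crossing-from : ∀ c → InSep G a b (hAt G H (c + 0)) → Z (hAt G H (c + 1)) → ∀ iw → W (hv H iw) → Crossing H a b Z W
    crossing-from c s₀ z₁ iw w = from-offset (hAt-offset G H c iw)
      where
      from-offset : ∃[ t ] (t < L × hAt G H (c + t) ≡ hv H iw) → Crossing H a b Z W
      from-offset (zero , _ , f₀≡) = ⊥-elim (W.∉sep (subst W (sym f₀≡) w) s₀)
      from-offset (suc t , t<L , fₜ≡) with sep-after S H c (s≤s z≤n) z₁ (λ z → disjoint z (subst W (sym fₜ≡) w))
      ... | m , 1<m , m≤t , sₘ , zone = crossing-between c m 1<m (≤-<-trans m≤t t<L) s₀ sₘ zone t<L (subst W (sym fₜ≡) w)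

  module _ {a b Z W} (S : Separation G a b Z W) (H : Hole G) where
    open Separation S
    private
      module Z = Side G S
      module W = Side G (swapSep G S)

    crossing-at : ∀ c → InSep G a b (hAt G H (c + 0)) → ∀ iz → Z (hv H iz) → ∀ iw → W (hv H iw) → Crossing H a b Z W
    crossing-at c s₀ iz z iw w = [ (λ z₁ → crossing-from S H c s₀ z₁ iw w)
                                 , (λ w₁ → swapCrossing (crossing-from (swapSep G S) H c s₀ w₁ iz z)) ]′ (Z⊎W G S next∉)
      where
      next∉ : ¬ InSep G a b (hAt G H (c + 1))
      next∉ s₁ = InSep-nonadj G S s₀ s₁ (λ e → 0≢1+n (hAt-offset-injective G H c (≤-trans (s≤s z≤n) (hlen≥4 H)) (≤-trans (s≤s (s≤s z≤n)) (hlen≥4 H)) e))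
                   (hAt-offset-step G H c 0)

    crossing : ∀ iz → Z (hv H iz) → ∀ iw → W (hv H iw) → Crossing H a b Z W
    crossing iz z iw w = from-offset (hAt-offset G H (toℕ iz) iw)
      where
      c = toℕ iz
      z₀ : Z (hAt G H (c + 0))
      z₀ = subst Z (sym (trans (cong (hAt G H) (+-identityʳ c)) (hAt-vx G H iz))) z
      from-offset : ∃[ t ] (t < hlen H × hAt G H (c + t) ≡ hv H iw) → Crossing H a b Z W
      from-offset (t , _ , fₜ≡) with sep-after S H c z≤n z₀ (λ z′ → disjoint z′ (subst W (sym fₜ≡) w))
      ... | j , _ , _ , sⱼ , _ = crossing-at (c + j) (subst (InSep G a b) (cong (hAt G H) (sym (+-identityʳ (c + j)))) sⱼ) iz z iw w

    classify : (∀ i → _∪ab G Z a b (hv H i)) ⊎ (∀ i → _∪ab G W a b (hv H i)) ⊎ Crossing H a b Z W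
    classify with Fin.any? (λ i → W.dec (hv H i))
    ... | no no-W = inj₁ (λ i → Z.within (λ w → no-W (i , w)))
    ... | yes (iw , w) with Fin.any? (λ i → Z.dec (hv H i))
    ...   | no no-Z = inj₂ (inj₁ (λ i → W.within (λ z → no-Z (i , z))))
    ...   | yes (iz , z) = inj₂ (inj₂ (crossing iz z iw w))

-- Counting neighbours on a hole

ind : Bool → ℕ
ind true = 1
ind false = 0

ind-mono : ∀ {x y} → (T x → T y) → ind x ≤ ind y
ind-mono {false} _ = z≤n
ind-mono {true} {true} _ = ≤-refl
ind-mono {true} {false} x⇒y = ⊥-elim (x⇒y _)

ind-∨ : ∀ x y → ind (x ∨ y) ≤ ind x + ind y
ind-∨ false y = ≤-refl
ind-∨ true false = ≤-refl
ind-∨ true true = s≤s z≤n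

count : (ℕ → Bool) → ℕ → ℕ
count f zero = 0
count f (suc N) = ind (f 0) + count (f ∘ suc) N

countFin : ∀ {L} → (Fin L → Bool) → ℕ
countFin {zero} p = 0
countFin {suc L} p = ind (p fzero) + countFin (p ∘ fsuc)

length-filterᵇ-tabulate : ∀ {M L} (p : Fin M → Bool) (f : Fin L → Fin M) → List.length (filterᵇ p (tabulate f)) ≡ countFin (p ∘ f)
length-filterᵇ-tabulate {L = zero} p f = refl
length-filterᵇ-tabulate {L = suc L} p f with p (f fzero)
... | true = cong suc (length-filterᵇ-tabulate p (f ∘ fsuc))
... | false = length-filterᵇ-tabulate p (f ∘ fsuc)

countFin-cong : ∀ {L} {p q : Fin L → Bool} → (∀ i → p i ≡ q i) → countFin p ≡ countFin q
countFin-cong {zero} _ = refl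
countFin-cong {suc L} p≗q = cong₂ _+_ (cong ind (p≗q fzero)) (countFin-cong (p≗q ∘ fsuc))

countFin-toℕ : ∀ L (q : ℕ → Bool) → countFin {L} (q ∘ toℕ) ≡ count q L
countFin-toℕ zero q = refl
countFin-toℕ (suc L) q = cong (ind (q 0) +_) (countFin-toℕ L (q ∘ suc))

count-cong : ∀ N {f g : ℕ → Bool} → (∀ {k} → k < N → f k ≡ g k) → count f N ≡ count g N
count-cong zero _ = refl
count-cong (suc N) f≗g = cong₂ _+_ (cong ind (f≗g z<s)) (count-cong N (f≗g ∘ s≤s))

count-false : ∀ N {f : ℕ → Bool} → (∀ {k} → k < N → f k ≡ false) → count f N ≡ 0
count-false zero _ = refl
count-false (suc N) {f} none rewrite none {0} z<s = count-false N (none ∘ s≤s)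

count-+ : ∀ m r (f : ℕ → Bool) → count f (m + r) ≡ count f m + count (λ k → f (m + k)) r
count-+ zero r f = refl
count-+ (suc m) r f = trans (cong (ind (f 0) +_) (count-+ m r (f ∘ suc))) (sym (+-assoc (ind (f 0)) _ _))

count-last : ∀ N (f : ℕ → Bool) → count f (suc N) ≡ count f N + ind (f N)
count-last N f = begin
  count f (suc N)                             ≡⟨ cong (count f) (+-comm 1 N) ⟩
  count f (N + 1)                             ≡⟨ count-+ N 1 f ⟩
  count f N + (ind (f (N + 0)) + 0)           ≡⟨ cong (count f N +_) (trans (+-identityʳ _) (cong (ind ∘ f) (+-identityʳ N))) ⟩
  count f N + ind (f N)                       ∎
  where open ≡-Reasoning

count-rotate : ∀ L (f : ℕ → Bool) → (∀ k → f (k + L) ≡ f k) → ∀ c → count (λ k → f (c + k)) L ≡ count f L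
count-rotate zero f _ c = refl
count-rotate (suc N) f _ zero = refl
count-rotate (suc N) f periodic (suc c) = begin
  count (λ k → f (suc c + k)) (suc N)       ≡⟨ count-cong (suc N) (λ {k} _ → cong f (sym (+-suc c k))) ⟩
  count (g ∘ suc) (suc N)                   ≡⟨ count-last N (g ∘ suc) ⟩
  count (g ∘ suc) N + ind (g (suc N))       ≡⟨ cong (λ x → count (g ∘ suc) N + ind x) wrap ⟩
  count (g ∘ suc) N + ind (g 0)             ≡⟨ +-comm (count (g ∘ suc) N) _ ⟩
  count g (suc N)                           ≡⟨ count-rotate (suc N) f periodic c ⟩
  count f (suc N)                           ∎
  where
  open ≡-Reasoning
  g : ℕ → Bool
  g k = f (c + k)
  wrap : g (suc N) ≡ g 0
  wrap = trans (periodic c) (cong f (sym (+-identityʳ c)))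

count-mono : ∀ N {f g : ℕ → Bool} → (∀ {k} → k < N → T (f k) → T (g k)) → count f N ≤ count g N
count-mono zero _ = z≤n
count-mono (suc N) f⇒g = +-mono-≤ (ind-mono (f⇒g z<s)) (count-mono N (f⇒g ∘ s≤s))

count-∨ : ∀ N (f g : ℕ → Bool) → count (λ k → f k ∨ g k) N ≤ count f N + count g N
count-∨ zero f g = z≤n
count-∨ (suc N) f g = begin
  ind (f 0 ∨ g 0) + count (λ k → f (suc k) ∨ g (suc k)) N   ≤⟨ +-mono-≤ (ind-∨ (f 0) (g 0)) (count-∨ N (f ∘ suc) (g ∘ suc)) ⟩
  (ind (f 0) + ind (g 0)) + (count (f ∘ suc) N + count (g ∘ suc) N)  ≡⟨ interchange (ind (f 0)) _ _ _ ⟩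
  (ind (f 0) + count (f ∘ suc) N) + (ind (g 0) + count (g ∘ suc) N)  ∎
  where open ≤-Reasoning

count-≟≤1 : ∀ {n} N (h : ℕ → Fin n) (a : Fin n) → (∀ {k k′} → k < N → k′ < N → h k ≡ h k′ → k ≡ k′)
          → count (λ k → does (h k Fin.≟ a)) N ≤ 1
count-≟≤1 zero h a _ = z≤n
count-≟≤1 (suc N) h a injective with h N Fin.≟ a in eq
... | yes hN≡a = begin
  count f (suc N)       ≡⟨ count-last N f ⟩
  count f N + ind (f N) ≡⟨ cong₂ _+_ (count-false N none-before) (cong (ind ∘ does) eq) ⟩
  1                     ∎
  where
  open ≤-Reasoning
  f = λ k → does (h k Fin.≟ a)
  none-before : ∀ {k} → k < N → f k ≡ false
  none-before {k} k<N with h k Fin.≟ a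
  ... | no _ = refl
  ... | yes hk≡a = ⊥-elim (<-irrefl (injective (m<n⇒m<1+n k<N) ≤-refl (trans hk≡a (sym hN≡a))) k<N)
... | no _ = begin
  count f (suc N)       ≡⟨ count-last N f ⟩
  count f N + ind (f N) ≡⟨ cong (λ x → count f N + ind (does x)) eq ⟩
  count f N + 0         ≡⟨ +-identityʳ _ ⟩
  count f N             ≤⟨ count-≟≤1 N h a (λ k< k′< → injective (m<n⇒m<1+n k<) (m<n⇒m<1+n k′<)) ⟩
  1                     ∎
  where
  open ≤-Reasoning
  f = λ k → does (h k Fin.≟ a)

module _ {n : ℕ} (G : Graph n) where
  open Graph G

  nbrCount≡count : ∀ x (H : Hole G) → nbrCount G x H ≡ count (λ k → E x (hAt G H k)) (hlen H)
  nbrCount≡count x H = begin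
    nbrCount G x H                                 ≡⟨ length-filterᵇ-tabulate (λ i → E x (hv H i)) id ⟩
    countFin {hlen H} (λ i → E x (hv H i))               ≡⟨ countFin-cong {hlen H} (λ i → cong (E x) (sym (hAt-vx G H i))) ⟩
    countFin {hlen H} (λ i → E x (hAt G H (toℕ i)))       ≡⟨ countFin-toℕ (hlen H) (λ k → E x (hAt G H k)) ⟩
    count (λ k → E x (hAt G H k)) (hlen H)         ∎
    where open ≡-Reasoning

  nbrCount-arc : ∀ x (H : Hole G) c m → m < hlen H → (∀ {k} → m < k → k < hlen H → ¬ Adj G x (hAt G H (c + k)))
               → nbrCount G x H ≡ count (λ k → E x (hAt G H (c + k))) (suc m)
  nbrCount-arc x H c m m<L outside = begin
    nbrCount G x H                                        ≡⟨ nbrCount≡count x H ⟩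
    count f L                                             ≡⟨ count-rotate L f (λ k → cong (E x) (hAt-periodic G H k)) c ⟨
    count (λ k → f (c + k)) L                             ≡⟨ cong (count (λ k → f (c + k))) (m+[n∸m]≡n m<L) ⟨
    count (λ k → f (c + k)) (suc m + (L ∸ suc m))         ≡⟨ count-+ (suc m) (L ∸ suc m) (λ k → f (c + k)) ⟩
    count (λ k → f (c + k)) (suc m) + count _ (L ∸ suc m) ≡⟨ cong (count (λ k → f (c + k)) (suc m) +_) (count-false (L ∸ suc m) none) ⟩
    count (λ k → f (c + k)) (suc m) + 0                   ≡⟨ +-identityʳ _ ⟩
    count (λ k → f (c + k)) (suc m)                       ∎
    where
    open ≡-Reasoning
    L = hlen H
    f : ℕ → Bool
    f k = E x (hAt G H k)
    none : ∀ {k} → k < L ∸ suc m → f (c + (suc m + k)) ≡ false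
    none {k} k< = ¬T⇒false (outside (s≤s (m≤m+n m k)) (subst (suc m + k <_) (m+[n∸m]≡n m<L) (+-monoʳ-< (suc m) k<)))
      where
      ¬T⇒false : ∀ {b} → ¬ T b → b ≡ false
      ¬T⇒false {true} ¬t = ⊥-elim (¬t _)
      ¬T⇒false {false} _ = refl

  nbrCount≤2 : ∀ x (H : Hole G) a b → (∀ {k} → k < hlen H → Adj G x (hAt G H k) → InSep G a b (hAt G H k)) → nbrCount G x H ≤ 2
  nbrCount≤2 x H a b only-sep = begin
    nbrCount G x H                          ≡⟨ nbrCount≡count x H ⟩
    count (λ k → E x (hAt G H k)) L          ≤⟨ count-mono L into-sep ⟩
    count (λ k → is a k ∨ is b k) L          ≤⟨ count-∨ L (is a) (is b) ⟩
    count (is a) L + count (is b) L          ≤⟨ +-mono-≤ (count-≟≤1 L (hAt G H) a injective) (count-≟≤1 L (hAt G H) b injective) ⟩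
    2                                        ∎
    where
    open ≤-Reasoning
    L = hlen H
    is : Fin n → ℕ → Bool
    is v k = does (hAt G H k Fin.≟ v)
    injective : ∀ {k k′} → k < L → k′ < L → hAt G H k ≡ hAt G H k′ → k ≡ k′
    injective = hAt-offset-injective G H 0
    into-sep : ∀ {k} → k < L → T (E x (hAt G H k)) → T (is a k ∨ is b k)
    into-sep {k} k<L xk with only-sep k<L xk | hAt G H k Fin.≟ a | hAt G H k Fin.≟ b
    ... | _ | yes _ | _ = _
    ... | _ | no _ | yes _ = _
    ... | inj₁ k≡a | no k≢a | no _ = k≢a k≡a
    ... | inj₂ k≡b | no _ | no k≢b = k≢b k≡b

-- Sectors

module _ {n : ℕ} (G : Graph n) (H : Hole G) where
  private
    L = hlen H
    instance _ = hlen-nonZero H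

  record SectorAt (y x : Fin n) (p l : ℕ) : Set where
    field
      l≥1       : 1 ≤ l
      l<L       : l < L
      start-adj : Adj G y (hAt G H p)
      end-adj   : Adj G y (hAt G H (p + l))
      gap       : ∀ {t} → 0 < t → t < l → ¬ Adj G y (hAt G H (p + t))
      covers    : ∀ k → Adj G x (hAt G H k) → ∃[ t ] (t ≤ l × hAt G H (p + t) ≡ hAt G H k)

  CycStep⇒% : ∀ i t {j} → j < L → CycStep G L i t j → (i + t) % L ≡ j
  CycStep⇒% _ _ j<L (inj₁ eq) = trans (cong (_% L) eq) (m<n⇒m%n≡m j<L)
  CycStep⇒% _ _ {j} j<L (inj₂ eq) = trans (cong (_% L) eq) (trans ([m+n]%n≡m%n j L) (m<n⇒m%n≡m j<L))

  %⇒CycStep : ∀ {i t} → i < L → t < L → CycStep G L i t ((i + t) % L)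
  %⇒CycStep {i} {t} i<L t<L with ≤⊎> L (i + t)
  ... | inj₂ i+t<L = inj₁ (sym (m<n⇒m%n≡m i+t<L))
  ... | inj₁ L≤i+t = inj₂ (begin
    i + t              ≡⟨ m∸n+n≡m L≤i+t ⟨
    r + L              ≡⟨ cong (_+ L) r≡ ⟨
    (i + t) % L + L    ∎)
    where
    open ≡-Reasoning
    r = i + t ∸ L
    r<L : r < L
    r<L = +-cancelˡ-< L _ _ (subst (_< L + L) (sym (m+[n∸m]≡n L≤i+t)) (+-mono-< i<L t<L))
    r≡ : (i + t) % L ≡ r
    r≡ = trans (cong (_% L) (sym (m∸n+n≡m L≤i+t))) (trans ([m+n]%n≡m%n r L) (m<n⇒m%n≡m r<L))

  module _ {y x : Fin n} {p l : ℕ} (σ : SectorAt y x p l) where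
    open SectorAt σ

    SectorAt-adj⇔ : ∀ {t} → t ≤ l → Adj G y (hAt G H (p + t)) ⇔ (t ≡ 0 ⊎ t ≡ l)
    SectorAt-adj⇔ {t} t≤l = mk⇔ ends ends⁻¹
      where
      ends : Adj G y (hAt G H (p + t)) → t ≡ 0 ⊎ t ≡ l
      ends adj with t ≟ 0 | m≤n⇒m<n∨m≡n t≤l
      ... | yes t≡0 | _ = inj₁ t≡0
      ... | no _ | inj₂ t≡l = inj₂ t≡l
      ... | no t≢0 | inj₁ t<l = ⊥-elim (gap (n≢0⇒n>0 t≢0) t<l adj)
      ends⁻¹ : t ≡ 0 ⊎ t ≡ l → Adj G y (hAt G H (p + t))
      ends⁻¹ (inj₁ refl) = subst (λ k → Adj G y (hAt G H k)) (sym (+-identityʳ p)) start-adj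
      ends⁻¹ (inj₂ refl) = end-adj

    SectorAt⇒SectorContains : SectorContains G H y x
    SectorAt⇒SectorContains = i , l , (l≥1 , l<L , sector) , contained
      where
      i : Fin L
      i = fromℕ< (m%n<n p L)
      i+t≡ : ∀ t → (toℕ i + t) % L ≡ (p + t) % L
      i+t≡ t = trans (cong (λ r → (r + t) % L) (Fin.toℕ-fromℕ< _)) (%-absorbˡ L p t)
      sector : ∀ j t → t ≤ l → CycStep G L (toℕ i) t (toℕ j) → Adj G y (hv H j) ⇔ (t ≡ 0 ⊎ t ≡ l)
      sector j t t≤l i→j = subst (λ v → Adj G y v ⇔ (t ≡ 0 ⊎ t ≡ l)) at (SectorAt-adj⇔ t≤l)
        where
        at : hAt G H (p + t) ≡ hv H j
        at = trans (hAt-cong G H (trans (sym (i+t≡ t)) (trans (CycStep⇒% (toℕ i) t (Fin.toℕ<n j) i→j) (sym (m<n⇒m%n≡m (Fin.toℕ<n j))))))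
                   (hAt-vx G H j)
      contained : ∀ j → Adj G x (hv H j) → InSector G H i l j
      contained j adj with covers (toℕ j) (subst (Adj G x) (sym (hAt-vx G H j)) adj)
      ... | t , t≤l , eq = t , t≤l , subst (CycStep G L (toℕ i) t) i+t≡j (%⇒CycStep (Fin.toℕ<n i) (≤-<-trans t≤l l<L))
        where
        i+t≡j : (toℕ i + t) % L ≡ toℕ j
        i+t≡j = trans (i+t≡ t) (trans (hAt-injective G H eq) (m<n⇒m%n≡m (Fin.toℕ<n j)))

  SectorContains⇒SectorAt : ∀ {y x} → SectorContains G H y x → ∃₂ λ p l → SectorAt y x p l
  SectorContains⇒SectorAt {y} {x} (i , l , (l≥1 , l<L , sector) , contained) = p , l , record
    { l≥1 = l≥1 ; l<L = l<L
    ; start-adj = subst (λ k → Adj G y (hAt G H k)) (+-identityʳ p) (from (adj⇔ z≤n) (inj₁ refl))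
    ; end-adj = from (adj⇔ ≤-refl) (inj₂ refl)
    ; gap = λ 0<t t<l adj → [ (λ t≡0 → <⇒≢ 0<t (sym t≡0)) , <⇒≢ t<l ]′ (to (adj⇔ (<⇒≤ t<l)) adj)
    ; covers = covers }
    where
    p = toℕ i
    adj⇔ : ∀ {t} → t ≤ l → Adj G y (hAt G H (p + t)) ⇔ (t ≡ 0 ⊎ t ≡ l)
    adj⇔ {t} t≤l = sector _ t t≤l (subst (CycStep G L p t) (sym (Fin.toℕ-fromℕ< _)) (%⇒CycStep (Fin.toℕ<n i) (≤-<-trans t≤l l<L)))
    covers : ∀ k → Adj G x (hAt G H k) → ∃[ t ] (t ≤ l × hAt G H (p + t) ≡ hAt G H k)
    covers k adj with contained _ adj
    ... | t , t≤l , i→j = t , t≤l , hAt-cong G H (trans (CycStep⇒% p t (Fin.toℕ<n _) i→j) (Fin.toℕ-fromℕ< _))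

  SectorAt-rebase : ∀ {y x p l} c → SectorAt y x p l → ∃[ k₀ ] (k₀ < L × SectorAt y x (c + k₀) l)
  SectorAt-rebase {y} {x} {p} {l} c σ = k₀ , k₀<L , record
    { l≥1 = l≥1 ; l<L = l<L
    ; start-adj = subst (Adj G y) (sym p≡) start-adj
    ; end-adj = subst (Adj G y) (shift l) end-adj
    ; gap = λ 0<t t<l adj → gap 0<t t<l (subst (Adj G y) (sym (shift _)) adj)
    ; covers = λ k adj → map₂ (λ {t} → map₂ (trans (sym (shift t)))) (covers k adj) }
    where
    open SectorAt σ
    offset = hAt-offset G H c (fromℕ< (m%n<n p L))
    k₀ = proj₁ offset
    k₀<L = proj₁ (proj₂ offset)
    p≡ : hAt G H (c + k₀) ≡ hAt G H p
    p≡ = proj₂ (proj₂ offset)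
    shift : ∀ t → hAt G H (p + t) ≡ hAt G H (c + k₀ + t)
    shift t = hAt-cong G H (%-cong-+ʳ L t (hAt-injective G H (sym p≡)))

-- A sector seen from an arc [0, m] of positions containing all neighbours of x and y on
-- the hole: it lies inside the arc, or it wraps around through the rest of the hole.
data ArcSector (Y X : ℕ → Set) (m : ℕ) : Set where
  straight : ∀ {p q} → p < q → q ≤ m → Y p → Y q → (∀ {k} → p < k → k < q → ¬ Y k)
        → (∀ {k} → k ≤ m → X k → p ≤ k × k ≤ q) → ArcSector Y X m
  wrapped  : ∀ {p q} → q < p → p ≤ m → Y p → Y q → (∀ {k} → p < k → k ≤ m → ¬ Y k) → (∀ {k} → k < q → ¬ Y k)
        → (∀ {k} → k ≤ m → X k → k ≤ q ⊎ p ≤ k) → ArcSector Y X m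

ArcSector-map : ∀ {Y X Y′ X′ : ℕ → Set} {m} → (∀ {k} → k ≤ m → Y k → Y′ k) → (∀ {k} → k ≤ m → Y′ k → Y k)
              → (∀ {k} → k ≤ m → X′ k → X k) → ArcSector Y X m → ArcSector Y′ X′ m
ArcSector-map Y⇒ Y⇐ X⇐ (straight p<q q≤m yp yq gap covered) =
  straight p<q q≤m (Y⇒ (<⇒≤ (<-≤-trans p<q q≤m)) yp) (Y⇒ q≤m yq)
        (λ p<k k<q y′ → gap p<k k<q (Y⇐ (<⇒≤ (<-≤-trans k<q q≤m)) y′))
        (λ k≤m x′ → covered k≤m (X⇐ k≤m x′))
ArcSector-map Y⇒ Y⇐ X⇐ (wrapped q<p p≤m yp yq gap₁ gap₂ covered) =
  wrapped q<p p≤m (Y⇒ p≤m yp) (Y⇒ (<⇒≤ (<-≤-trans q<p p≤m)) yq)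
       (λ p<k k≤m y′ → gap₁ p<k k≤m (Y⇐ k≤m y′))
       (λ k<q y′ → gap₂ k<q (Y⇐ (<⇒≤ (<-≤-trans (<-trans k<q q<p) p≤m)) y′))
       (λ k≤m x′ → covered k≤m (X⇐ k≤m x′))

module _ {n : ℕ} (G : Graph n) (H : Hole G) (c m : ℕ) (m+1<L : suc m < hlen H) {y x : Fin n}
         (y-out : ∀ {k} → m < k → k < hlen H → ¬ Adj G y (hAt G H (c + k)))
         (x-out : ∀ {k} → m < k → k < hlen H → ¬ Adj G x (hAt G H (c + k))) where
  private
    L = hlen H
    φ : ℕ → Fin n
    φ k = hAt G H (c + k)
    Y X : ℕ → Set
    Y k = Adj G y (φ k)
    X k = Adj G x (φ k)
    m<L : m < L
    m<L = <-trans ≤-refl m+1<L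
    assoc : ∀ k t → hAt G H (c + k + t) ≡ φ (k + t)
    assoc k t = cong (hAt G H) (+-assoc c k t)

  module _ {k₀ l : ℕ} (k₀<L : k₀ < L) (σ : SectorAt G H y x (c + k₀) l) where
    open SectorAt σ
    private
      y₀ : Y k₀
      y₀ = start-adj
      yₗ : Y (k₀ + l)
      yₗ = subst (Adj G y) (assoc k₀ l) end-adj
      gap′ : ∀ {k} → k₀ < k → k < k₀ + l → ¬ Y k
      gap′ k₀<k k< with ≤⊎+ k₀ _
      ... | inj₁ k≤k₀ = ⊥-elim (<⇒≱ k₀<k k≤k₀)
      ... | inj₂ (t , 0<t , refl) = λ yk → gap 0<t (+-cancelˡ-< k₀ t l k<) (subst (Adj G y) (sym (assoc k₀ t)) yk)
      covers′ : ∀ {k} → X k → ∃[ t ] (t ≤ l × φ (k₀ + t) ≡ φ k)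
      covers′ xk = map₂ (map₂ (trans (sym (assoc k₀ _)))) (covers _ xk)
      k₀≤m : k₀ ≤ m
      k₀≤m with ≤⊎> k₀ m
      ... | inj₁ k₀≤m = k₀≤m
      ... | inj₂ m<k₀ = ⊥-elim (y-out m<k₀ k₀<L y₀)

    sector⇒arc-straight : k₀ + l ≤ m → ArcSector Y X m
    sector⇒arc-straight k₀+l≤m = straight (m<m+n k₀ l≥1) k₀+l≤m y₀ yₗ gap′ covered
      where
      covered : ∀ {k} → k ≤ m → X k → k₀ ≤ k × k ≤ k₀ + l
      covered k≤m xk with covers′ xk
      ... | t , t≤l , eq with hAt-offset-injective G H c (≤-<-trans (≤-trans (+-monoʳ-≤ k₀ t≤l) k₀+l≤m) m<L) (≤-<-trans k≤m m<L) eq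
      ...   | refl = m≤m+n k₀ t , +-monoʳ-≤ k₀ t≤l

    sector⇒arc-wrapped : m < k₀ + l → ArcSector Y X m
    sector⇒arc-wrapped m<k₀+l = wrapped q<k₀ k₀≤m y₀ y-q gap₁ gap₂ covered
      where
      L≤ : L ≤ k₀ + l
      L≤ with ≤⊎> L (k₀ + l)
      ... | inj₁ L≤ = L≤
      ... | inj₂ k₀+l<L = ⊥-elim (y-out m<k₀+l k₀+l<L yₗ)
      q = k₀ + l ∸ L
      q<k₀ : q < k₀
      q<k₀ = +-cancelʳ-< L q k₀ (subst (_< k₀ + L) (sym (m∸n+n≡m L≤)) (+-monoʳ-< k₀ l<L))
      y-q : Y q
      y-q = subst (Adj G y) (hAt-offset-wrap G H c L≤) yₗ
      gap₁ : ∀ {k} → k₀ < k → k ≤ m → ¬ Y k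
      gap₁ k₀<k k≤m = gap′ k₀<k (≤-<-trans k≤m m<k₀+l)
      gap₂ : ∀ {k} → k < q → ¬ Y k
      gap₂ {k} k<q yk = gap′ (<-≤-trans k₀<L (m≤m+n L k)) (subst (L + k <_) (m+[n∸m]≡n L≤) (+-monoʳ-< L k<q))
                             (subst (Adj G y) (sym around) yk)
        where
        around : φ (L + k) ≡ φ k
        around = trans (hAt-offset-wrap G H c (m≤m+n L k)) (cong φ (m+n∸m≡n L k))
      covered : ∀ {k} → k ≤ m → X k → k ≤ q ⊎ k₀ ≤ k
      covered {k} k≤m xk with covers′ xk
      ... | t , t≤l , eq with ≤⊎> L (k₀ + t)
      ...   | inj₂ k₀+t<L = inj₂ (subst (k₀ ≤_) (hAt-offset-injective G H c k₀+t<L (≤-<-trans k≤m m<L) eq) (m≤m+n k₀ t))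
      ...   | inj₁ L≤k₀+t = inj₁ (subst (_≤ q) (hAt-offset-injective G H c r<L (≤-<-trans k≤m m<L) (trans (sym (hAt-offset-wrap G H c L≤k₀+t)) eq))
                                         (∸-monoˡ-≤ L (+-monoʳ-≤ k₀ t≤l)))
        where
        r<L : k₀ + t ∸ L < L
        r<L = ≤-<-trans (∸-monoˡ-≤ L (+-monoʳ-≤ k₀ t≤l)) (<-trans q<k₀ k₀<L)

  sector⇒arc : SectorContains G H y x → ArcSector Y X m
  sector⇒arc sc with SectorContains⇒SectorAt G H sc
  ... | p , l , σ with SectorAt-rebase G H c σ
  ...   | k₀ , k₀<L , σ′ with ≤⊎> (k₀ + l) m
  ...     | inj₁ k₀+l≤m = sector⇒arc-straight k₀<L σ′ k₀+l≤m
  ...     | inj₂ m<k₀+l = sector⇒arc-wrapped k₀<L σ′ m<k₀+l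

  private
    around : ∀ k → φ (L + k) ≡ φ k
    around k = trans (hAt-offset-wrap G H c (m≤m+n L k)) (cong φ (m+n∸m≡n L k))

    sector-from : ∀ {p l} → 1 ≤ l → l < L → Y p → Y (p + l) → (∀ {t} → 0 < t → t < l → ¬ Y (p + t))
                → (∀ {k} → k ≤ m → X k → ∃[ t ] (t ≤ l × φ (p + t) ≡ φ k)) → SectorContains G H y x
    sector-from {p} {l} l≥1 l<L yp yₗ gap covered = SectorAt⇒SectorContains G H record
      { l≥1 = l≥1 ; l<L = l<L ; start-adj = yp
      ; end-adj = subst (Adj G y) (sym (assoc p l)) yₗ
      ; gap = λ 0<t t<l yt → gap 0<t t<l (subst (Adj G y) (assoc p _) yt)
      ; covers = covers }
      where
      covers : ∀ k → Adj G x (hAt G H k) → ∃[ t ] (t ≤ l × hAt G H (c + p + t) ≡ hAt G H k)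
      covers k xk with hAt-offset G H c (fromℕ< (m%n<n k L {{hlen-nonZero H}}))
      ... | k′ , k′<L , k′≡ with ≤⊎> k′ m
      ...   | inj₂ m<k′ = ⊥-elim (x-out m<k′ k′<L (subst (Adj G x) (sym k′≡) xk))
      ...   | inj₁ k′≤m = map₂ (map₂ (λ eq → trans (assoc p _) (trans eq k′≡))) (covered k′≤m (subst (Adj G x) (sym k′≡) xk))

  arc⇒sector : ArcSector Y X m → SectorContains G H y x
  arc⇒sector (straight {p} {q} p<q q≤m yp yq gap covered) =
    sector-from (m<n⇒0<n∸m p<q) (≤-<-trans (≤-trans (m∸n≤m q p) q≤m) m<L) yp (subst Y (sym p+l≡q) yq)
      (λ 0<t t<l → gap (m<m+n p 0<t) (subst (p + _ <_) p+l≡q (+-monoʳ-< p t<l)))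
      covered′
    where
    covered′ : ∀ {k} → k ≤ m → X k → ∃[ t ] (t ≤ q ∸ p × φ (p + t) ≡ φ k)
    covered′ {k} k≤m xk with covered k≤m xk
    ... | p≤k , k≤q = k ∸ p , ∸-monoˡ-≤ p k≤q , cong φ (m+[n∸m]≡n p≤k)
    p+l≡q : p + (q ∸ p) ≡ q
    p+l≡q = m+[n∸m]≡n (<⇒≤ p<q)
  arc⇒sector (wrapped {p} {q} q<p p≤m yp yq gap₁ gap₂ covered) =
    sector-from (≤-trans (m<n⇒0<n∸m p<L) (m≤m+n _ q)) l<L yp (subst (Adj G y) (sym (trans (cong φ p+l≡) (around q))) yq)
      gap covered′
    where
    p<L = ≤-<-trans p≤m m<L
    l = L ∸ p + q
    p+l≡ : p + l ≡ L + q
    p+l≡ = trans (sym (+-assoc p (L ∸ p) q)) (cong (_+ q) (m+[n∸m]≡n (<⇒≤ p<L)))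
    l<L : l < L
    l<L = subst (l <_) (m∸n+n≡m (<⇒≤ p<L)) (+-monoʳ-< (L ∸ p) q<p)
    gap : ∀ {t} → 0 < t → t < l → ¬ Y (p + t)
    gap {t} 0<t t<l with ≤⊎> (p + t) m
    ... | inj₁ p+t≤m = gap₁ (m<m+n p 0<t) p+t≤m
    ... | inj₂ m<p+t with ≤⊎> L (p + t)
    ...   | inj₂ p+t<L = y-out m<p+t p+t<L
    ...   | inj₁ L≤p+t = λ y-pt → gap₂ s<q (subst (Adj G y) (hAt-offset-wrap G H c L≤p+t) y-pt)
      where
      s<q : p + t ∸ L < q
      s<q = +-cancelˡ-< L _ q (subst (_< L + q) (sym (m+[n∸m]≡n L≤p+t)) (subst (p + t <_) p+l≡ (+-monoʳ-< p t<l)))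
    covered′ : ∀ {k} → k ≤ m → X k → ∃[ t ] (t ≤ l × φ (p + t) ≡ φ k)
    covered′ {k} k≤m xk with covered k≤m xk
    ... | inj₁ k≤q = L ∸ p + k , +-monoʳ-≤ (L ∸ p) k≤q ,
                     trans (cong φ (trans (sym (+-assoc p (L ∸ p) k)) (cong (_+ k) (m+[n∸m]≡n (<⇒≤ p<L))))) (around k)
    ... | inj₂ p≤k = k ∸ p , ≤-trans (∸-monoˡ-≤ p (<⇒≤ (≤-<-trans k≤m m<L))) (m≤m+n (L ∸ p) q) , cong φ (m+[n∸m]≡n p≤k)

-- Blocks and exchanged holes

odd⇒%2≡1 : ∀ x → ¬ 2 ∣ x → x % 2 ≡ 1
odd⇒%2≡1 x odd with x % 2 in eq | m%n<n x 2
... | zero | _ = ⊥-elim (odd (m%n≡0⇒n∣m x 2 eq))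
... | suc zero | _ = refl
... | suc (suc _) | s≤s (s≤s ())

odd+odd : ∀ {x y} → ¬ 2 ∣ x → ¬ 2 ∣ y → 2 ∣ x + y
odd+odd {x} {y} odd-x odd-y = m%n≡0⇒n∣m (x + y) 2
  (trans (%-distribˡ-+ x y 2) (cong₂ (λ p q → (p + q) % 2) (odd⇒%2≡1 x odd-x) (odd⇒%2≡1 y odd-y)))

xor-injective : ∀ d {x y} → d xor x ≡ d xor y → x ≡ y
xor-injective false eq = eq
xor-injective true eq = not-injective eq

xor-not : ∀ x y → not x xor not y ≡ x xor y
xor-not x y = begin
  not x xor not y      ≡⟨ not-distribˡ-xor x (not y) ⟨
  not (x xor not y)    ≡⟨ cong not (not-distribʳ-xor x y) ⟨
  not (not (x xor y))  ≡⟨ not-involutive (x xor y) ⟩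
  x xor y              ∎
  where open ≡-Reasoning

module _ {n : ℕ} (G : Graph n) where

  -- The block of Z: Z ∪ {a, b} together with an aWb-path (the path Q of the paper for Z = X).
  record Block (a b : Fin n) (Z W : VSet G) : Set where
    field
      sep        : Separation G a b Z W
      path       : Path G
      path-start : pAt G path 0 ≡ a
      path-end   : pAt G path (len path) ≡ b
      path-inner : ∀ {k} → 0 < k → k < len path → W (pAt G path k)

    open Separation sep

    vertices : VSet G
    vertices = BlockSet G Z a b path

    path-long : 2 ≤ len path
    path-long with len path in eq
    ... | zero = ⊥-elim (a≢b (trans (sym path-start) (trans (cong (pAt G path) (sym eq)) path-end)))
    ... | suc zero = ⊥-elim (a≁b (subst₂ (Adj G) path-start (trans (cong (pAt G path) (sym eq)) path-end)
                                        (pAt-step G path (≤-reflexive (sym eq)))))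
    ... | suc (suc _) = s≤s (s≤s z≤n)

    path⊆ : ∀ {k} → k ≤ len path → vertices (pAt G path k)
    path⊆ {k} _ = inj₂ (clamp (len path) k , refl)

    side⊆ : ∀ {v} → _∪ab G Z a b v → vertices v
    side⊆ = inj₁

  mkBlock : ∀ {a b Z W} → Separation G a b Z W → (R : Path G) → IsAZBPath G a W b R → Block a b Z W
  mkBlock S R (R-start , R-end , R-inner) = record
    { sep = S ; path = R
    ; path-start = trans (pAt-start G R) R-start
    ; path-end = trans (pAt-end G R) R-end
    ; path-inner = λ 0<k k< → R-inner _ (interior G R 0<k k<) }

  module _ {a b Z W} (B : Block a b Z W) where
    open Block B

    record Route (u v : Fin n) : Set where
      field
        route       : Path G
        route-len   : len route ≡ len path
        route-start : pAt G route 0 ≡ u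
        route-end   : pAt G route (len route) ≡ v
        route-inner : ∀ {k} → 0 < k → k < len route → W (pAt G route k)
        route⊆      : ∀ {k} → k ≤ len route → vertices (pAt G route k)

      route-long : 2 ≤ len route
      route-long = subst (2 ≤_) (sym route-len) path-long

    mkRoute : ∀ {u v} → (u ≡ a × v ≡ b) ⊎ (u ≡ b × v ≡ a) → Route u v
    mkRoute (inj₁ (refl , refl)) = record
      { route = path ; route-len = refl ; route-start = path-start ; route-end = path-end
      ; route-inner = path-inner ; route⊆ = path⊆ }
    mkRoute (inj₂ (refl , refl)) = record
      { route = reverse G path ; route-len = refl
      ; route-start = trans (pAt-reverse G path z≤n) path-end
      ; route-end = trans (pAt-reverse G path ≤-refl) (trans (cong (pAt G path) (n∸n≡0 (len path))) path-start)
      ; route-inner = λ 0<k k< → subst W (sym (pAt-reverse G path (<⇒≤ k<))) (path-inner (m<n⇒0<n∸m k<) (∸-monoʳ-< 0<k (<⇒≤ k<)))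
      ; route⊆ = λ {k} k≤ → subst vertices (sym (pAt-reverse G path k≤)) (path⊆ (m∸n≤m (len path) k)) }

  -- The hole obtained from H by exchanging its W-arc for the path of the block.
  module Replace {a b Z W} (B : Block a b Z W) (H : Hole G) (X : Crossing G H a b Z W) where
    open Block B
    open Separation sep
    open Crossing X
    private
      A = arc G H c m m+1<L
      A-at : ∀ {k} → k ≤ m → pAt G A k ≡ hAt G H (c + k)
      A-at = pAt-arc G H c m m+1<L
      hc≡ : hAt G H (c + 0) ≡ hAt G H c
      hc≡ = cong (hAt G H) (+-identityʳ c)
      ρ : Route B (hAt G H (c + m)) (hAt G H c)
      ρ = mkRoute B (Sum.swap (Sum.map swap swap ends))
      open Route ρ
      gluable : Gluable G A route
      gluable = record
        { A-long = m≥2 ; B-long = route-long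
        ; meet₁ = trans (A-at ≤-refl) (sym route-start)
        ; meet₂ = trans route-end (sym (trans (A-at z≤n) hc≡))
        ; disjoint = λ 0<k k< 0<j j< eq → disjoint (subst Z (sym (A-at (<⇒≤ k<))) (inZ 0<k k<)) (subst W (sym eq) (route-inner 0<j j<))
        ; nonadjacent = λ 0<k k< 0<j j< → Z≁W (subst Z (sym (A-at (<⇒≤ k<))) (inZ 0<k k<)) (route-inner 0<j j<) }

    hole : Hole G
    hole = glue G gluable

    hole-len : hlen hole ≡ m + len path
    hole-len = cong (m +_) route-len

    hole-m+1< : suc m < hlen hole
    hole-m+1< = subst (_≤ m + len route) (+-comm m 2) (+-monoʳ-≤ m route-long)

    hole-arc : ∀ {k} → k ≤ m → hAt G hole k ≡ hAt G H (c + k)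
    hole-arc k≤ = trans (hAt-glueˡ G gluable k≤) (A-at k≤)

    hole-route : ∀ {j} → j < len route → hAt G hole (m + j) ≡ pAt G route j
    hole-route = hAt-glueʳ G gluable

    hole-W : ∀ {k} → m < k → k < hlen hole → W (hAt G hole k)
    hole-W {k} m<k k< with ≤⊎+ m k
    ... | inj₁ k≤m = ⊥-elim (<⇒≱ m<k k≤m)
    ... | inj₂ (j , 0<j , refl) = subst W (sym (hole-route j<)) (route-inner 0<j j<)
      where j< = +-cancelˡ-< m j (len route) k<

    arc-side : ∀ {k} → k ≤ m → Z (hAt G H (c + k)) ⊎ InSep G a b (hAt G H (c + k))
    arc-side {zero} _ = inj₂ (subst (InSep G a b) (sym hc≡) start∈)
    arc-side {suc k} k+1≤ with m≤n⇒m<n∨m≡n k+1≤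
    ... | inj₁ k+1<m = inj₁ (inZ z<s k+1<m)
    ... | inj₂ refl = inj₂ end∈

    hole⊆ : HoleIn G vertices hole
    hole⊆ i with ≤⊎+ m (toℕ i)
    ... | inj₁ i≤m = subst vertices (trans (sym (hole-arc i≤m)) (hAt-vx G hole i)) (side⊆ (arc-side i≤m))
    ... | inj₂ (j , _ , eq) = subst vertices (trans (sym (hole-route j<)) (trans (cong (hAt G hole) (sym eq)) (hAt-vx G hole i)))
                                (route⊆ (<⇒≤ j<))
      where j< = +-cancelˡ-< m j (len route) (subst (_< m + len route) eq (Fin.toℕ<n i))

    hole-crossing : Crossing G hole a b Z W
    hole-crossing = record
      { c = 0 ; m = m
      ; ends = Sum.map (λ (e₁ , e₂) → trans (trans (hole-arc z≤n) hc≡) e₁ , trans (hole-arc ≤-refl) e₂)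
                       (λ (e₁ , e₂) → trans (trans (hole-arc z≤n) hc≡) e₁ , trans (hole-arc ≤-refl) e₂) ends
      ; m≥2 = m≥2 ; m+1<L = hole-m+1<
      ; inZ = λ 0<k k< → subst Z (sym (hole-arc (<⇒≤ k<))) (inZ 0<k k<)
      ; inW = hole-W }

    module _ {x : Fin n} (zx : Z x) where

      hole-nbrCount : nbrCount G x hole ≡ nbrCount G x H
      hole-nbrCount = begin
        nbrCount G x hole                                   ≡⟨ nbrCount-arc G x hole 0 m (<-trans ≤-refl hole-m+1<) (λ m<k k< → Z≁W zx (hole-W m<k k<)) ⟩
        count (λ k → Graph.E G x (hAt G hole k)) (suc m)    ≡⟨ count-cong (suc m) (λ k< → cong (Graph.E G x) (hole-arc (≤-pred k<))) ⟩
        count (λ k → Graph.E G x (hAt G H (c + k))) (suc m) ≡⟨ nbrCount-arc G x H c m (<-trans ≤-refl m+1<L) (λ m<k k< → Z≁W zx (inW m<k k<)) ⟨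
        nbrCount G x H                                      ∎
        where open ≡-Reasoning

      hole-avoids : (∀ i → hv H i ≢ x) → ∀ i → hv hole i ≢ x
      hole-avoids x∉H i eq with ≤⊎+ m (toℕ i)
      ... | inj₁ i≤m = x∉H _ (trans (sym (hole-arc i≤m)) (trans (hAt-vx G hole i) eq))
      ... | inj₂ (j , 0<j , i≡) = disjoint zx (subst W (trans (hAt-vx G hole i) eq) (hole-W m<i (Fin.toℕ<n i)))
        where
        m<i : m < toℕ i
        m<i = subst (m <_) (sym i≡) (m<m+n m 0<j)

      hole-wheel : IsWheel G H x → IsWheel G hole x
      hole-wheel (x∉H , 3≤) = hole-avoids x∉H , subst (3 ≤_) (sym hole-nbrCount) 3≤

    hole-sector : ∀ {x y} → Z x → Z y → SectorContains G H y x ⇔ SectorContains G hole y x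
    hole-sector {x} {y} zx zy = mk⇔
      (λ sc → arc⇒sector G hole 0 m hole-m+1< (out′ zy) (out′ zx)
                (ArcSector-map (along y (sym ∘ hole-arc)) (along y hole-arc) (along x hole-arc) (sector⇒arc G H c m m+1<L (out zy) (out zx) sc)))
      (λ sc → arc⇒sector G H c m m+1<L (out zy) (out zx)
                (ArcSector-map (along y hole-arc) (along y (sym ∘ hole-arc)) (along x (sym ∘ hole-arc)) (sector⇒arc G hole 0 m hole-m+1< (out′ zy) (out′ zx) sc)))
      where
      out : ∀ {v} → Z v → ∀ {k} → m < k → k < hlen H → ¬ Adj G v (hAt G H (c + k))
      out zv m<k k< = Z≁W zv (inW m<k k<)
      out′ : ∀ {v} → Z v → ∀ {k} → m < k → k < hlen hole → ¬ Adj G v (hAt G hole k)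
      out′ zv m<k k< = Z≁W zv (hole-W m<k k<)
      along : ∀ v {f g : ℕ → Fin n} → (∀ {k} → k ≤ m → f k ≡ g k) → ∀ {k} → k ≤ m → Adj G v (f k) → Adj G v (g k)
      along v f≡g k≤m = subst (Adj G v) (f≡g k≤m)

  module _ {a b Z W} (S : Separation G a b Z W) {H : Hole G} {x : Fin n} where
    open Separation S

    -- A centre in W would see only a and b on the hole.
    center-inside : (∀ i → _∪ab G Z a b (hv H i)) → IsWheel G H x → _∪ab G Z a b x
    center-inside in-Z (_ , 3≤) with cover x
    ... | inj₁ x≡a = inj₂ (inj₁ x≡a)
    ... | inj₂ (inj₁ x≡b) = inj₂ (inj₂ x≡b)
    ... | inj₂ (inj₂ (inj₁ zx)) = inj₁ zx
    ... | inj₂ (inj₂ (inj₂ wx)) = ⊥-elim (<⇒≱ (s≤s (s≤s (s≤s z≤n))) (≤-trans 3≤ (nbrCount≤2 G x H a b only-sep)))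
      where
      only-sep : ∀ {k} → k < hlen H → Adj G x (hAt G H k) → InSep G a b (hAt G H k)
      only-sep _ adj with in-Z _
      ... | inj₁ z = ⊥-elim (Z≁W z wx (adj-sym G adj))
      ... | inj₂ k∈ = k∈

    center-crossing : Crossing G H a b Z W → (∀ i → hv H i ≢ x) → Z x ⊎ W x
    center-crossing X x∉H = Z⊎W G S x∉sep
      where
      open Crossing X
      x∉sep : ¬ InSep G a b x
      x∉sep x∈ = [ (λ x≡ → x∉H _ (sym x≡)) , (λ x≡ → x∉H _ (sym x≡)) ]′ (InSep-third G start∈ end∈ start≢end x∈)

  WacCopy : Wac G (Whole G) → VSet G → Set
  WacCopy w S = Σ (Wac G S) λ w′ → IsTurtle G w ⇔ IsTurtle G w′

  wac-replaced : ∀ {a b Z W} (B : Block a b Z W) (w : Wac G (Whole G)) → Crossing G (wH w) a b Z W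
               → Z (wx w) → Z (wy w) → WacCopy w (Block.vertices B)
  wac-replaced B w X zx zy = record
    { wH = hole ; wx = wx w ; wy = wy w ; wxy = wxy w ; wwx = hole-wheel zx (wwx w) ; wwy = hole-wheel zy (wwy w)
    ; winH = hole⊆ ; winx = Block.side⊆ B (inj₁ zx) ; winy = Block.side⊆ B (inj₁ zy) }
    , mk⇔ (Sum.map (to (hole-sector zx zy)) (to (hole-sector zy zx)))
          (Sum.map (from (hole-sector zx zy)) (from (hole-sector zy zx)))
    where open Replace B (wH w) X

  module _ {a b Z W} (B : Block a b Z W) (B′ : Block a b W Z) where
    private
      S = Block.sep B
      module B = Block B
      module B′ = Block B′
      module Z = Side G S
      module W = Side G (swapSep G S)
      open Separation S

    -- If both exchanged holes are odd, the hole made of the two block paths is even.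
    evenHole-crossing : ∀ {H} → 2 ∣ hlen H → Crossing G H a b Z W → EvenHole G B.vertices ⊎ EvenHole G B′.vertices
    evenHole-crossing {H} even X = pick (2 ∣? hlen R₁.hole) (2 ∣? hlen R₂.hole)
      where
      open Crossing X
      module R₁ = Replace B H X
      module R₂ = Replace B′ H (swapCrossing G X)
      module R₃ = Replace B′ R₁.hole (swapCrossing G R₁.hole-crossing)
      t = len B.path
      t′ = len B′.path
      len₃ : hlen R₃.hole ≡ t + t′
      len₃ = trans R₃.hole-len (cong (_+ t′) (trans (cong (_∸ m) R₁.hole-len) (m+n∸m≡n m t)))
      total : (m + t) + ((hlen H ∸ m) + t′) ≡ hlen H + (t + t′)
      total = trans (interchange m t (hlen H ∸ m) t′) (cong (_+ (t + t′)) (m+[n∸m]≡n m≤L))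
      pick : Dec (2 ∣ hlen R₁.hole) → Dec (2 ∣ hlen R₂.hole) → EvenHole G B.vertices ⊎ EvenHole G B′.vertices
      pick (yes even₁) _ = inj₁ record { ehH = R₁.hole ; eheven = even₁ ; ehin = R₁.hole⊆ }
      pick (no _) (yes even₂) = inj₂ record { ehH = R₂.hole ; eheven = even₂ ; ehin = R₂.hole⊆ }
      pick (no odd₁) (no odd₂) = inj₂ record { ehH = R₃.hole ; eheven = subst (2 ∣_) (sym len₃) even₃ ; ehin = R₃.hole⊆ }
        where
        odd+odd′ : 2 ∣ (m + t) + ((hlen H ∸ m) + t′)
        odd+odd′ = odd+odd (λ e → odd₁ (subst (2 ∣_) (sym R₁.hole-len) e)) (λ e → odd₂ (subst (2 ∣_) (sym R₂.hole-len) e))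
        even₃ : 2 ∣ t + t′
        even₃ = ∣m+n∣m⇒∣n (subst (2 ∣_) total odd+odd′) even


    evenHole-split : EvenHole G (Whole G) → EvenHole G B.vertices ⊎ EvenHole G B′.vertices
    evenHole-split record { ehH = H ; eheven = even } with classify G S H
    ... | inj₁ in-Z = inj₁ record { ehH = H ; eheven = even ; ehin = λ i → B.side⊆ (in-Z i) }
    ... | inj₂ (inj₁ in-W) = inj₂ record { ehH = H ; eheven = even ; ehin = λ i → B′.side⊆ (in-W i) }
    ... | inj₂ (inj₂ X) = evenHole-crossing even X

    evenWheel-split : EvenWheel G (Whole G) → EvenWheel G B.vertices ⊎ EvenWheel G B′.vertices
    evenWheel-split record { ewH = H ; ewc = x ; ewwheel = wheel ; eweven = even } with classify G S H
    ... | inj₁ in-Z = inj₁ record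
      { ewH = H ; ewc = x ; ewwheel = wheel ; eweven = even
      ; ewinH = λ i → B.side⊆ (in-Z i) ; ewinc = B.side⊆ (center-inside S {H} {x} in-Z wheel) }
    ... | inj₂ (inj₁ in-W) = inj₂ record
      { ewH = H ; ewc = x ; ewwheel = wheel ; eweven = even
      ; ewinH = λ i → B′.side⊆ (in-W i) ; ewinc = B′.side⊆ (center-inside (swapSep G S) {H} {x} in-W wheel) }
    ... | inj₂ (inj₂ X) with center-crossing S X (proj₁ wheel)
    ...   | inj₁ zx = inj₁ record
      { ewH = R.hole ; ewc = x ; ewwheel = R.hole-wheel zx wheel ; eweven = subst (2 ∣_) (sym (R.hole-nbrCount zx)) even
      ; ewinH = R.hole⊆ ; ewinc = B.side⊆ (inj₁ zx) }
      where module R = Replace B H X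
    ...   | inj₂ wx = inj₂ record
      { ewH = R.hole ; ewc = x ; ewwheel = R.hole-wheel wx wheel ; eweven = subst (2 ∣_) (sym (R.hole-nbrCount wx)) even
      ; ewinH = R.hole⊆ ; ewinc = B′.side⊆ (inj₁ wx) }
      where module R = Replace B′ H (swapCrossing G X)

    wacCopy-split : (w : Wac G (Whole G)) → WacCopy w B.vertices ⊎ WacCopy w B′.vertices
    wacCopy-split w with classify G S (wH w)
    ... | inj₁ in-Z = inj₁ (record
      { wH = wH w ; wx = wx w ; wy = wy w ; wxy = wxy w ; wwx = wwx w ; wwy = wwy w ; winH = λ i → B.side⊆ (in-Z i)
      ; winx = B.side⊆ (center-inside S {wH w} {wx w} in-Z (wwx w)) ; winy = B.side⊆ (center-inside S {wH w} {wy w} in-Z (wwy w)) } , mk⇔ id id)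
    ... | inj₂ (inj₁ in-W) = inj₂ (record
      { wH = wH w ; wx = wx w ; wy = wy w ; wxy = wxy w ; wwx = wwx w ; wwy = wwy w ; winH = λ i → B′.side⊆ (in-W i)
      ; winx = B′.side⊆ (center-inside (swapSep G S) {wH w} {wx w} in-W (wwx w))
      ; winy = B′.side⊆ (center-inside (swapSep G S) {wH w} {wy w} in-W (wwy w)) } , mk⇔ id id)
    ... | inj₂ (inj₂ X) with center-crossing S X (proj₁ (wwx w)) | center-crossing S X (proj₁ (wwy w))
    ...   | inj₁ zx | inj₂ wy = ⊥-elim (Z≁W zx wy (wxy w))
    ...   | inj₂ wx | inj₁ zy = ⊥-elim (Z≁W zy wx (adj-sym G (wxy w)))
    ...   | inj₁ zx | inj₁ zy = inj₁ (wac-replaced B w X zx zy)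
    ...   | inj₂ wx | inj₂ wy = inj₂ (wac-replaced B′ w (swapCrossing G X) wx wy)

    wac-split : Wac G (Whole G) → Wac G B.vertices ⊎ Wac G B′.vertices
    wac-split w = Sum.map drop drop (wacCopy-split w)
      where
      drop : ∀ {S} → WacCopy w S → Wac G S
      drop = proj₁

    turtle-split : Turtle G (Whole G) → Turtle G B.vertices ⊎ Turtle G B′.vertices
    turtle-split (w , turtle) = Sum.map keep keep (wacCopy-split w)
      where
      keep : ∀ {S} → WacCopy w S → Turtle G S
      keep (w′ , same) = w′ , to same turtle

    cwac-split : CWac G (Whole G) → CWac G B.vertices ⊎ CWac G B′.vertices
    cwac-split (w , ¬turtle) = Sum.map keep keep (wacCopy-split w)
      where
      keep : ∀ {S} → WacCopy w S → CWac G S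
      keep (w′ , same) = w′ , λ turtle → ¬turtle (from same turtle)

    private
      triangle-around : ∀ u v w → Adj G u v → Adj G u w → Adj G v w → Z u ⊎ W u
                      → Triangle G B.vertices ⊎ Triangle G B′.vertices
      triangle-around u v w uv uw vw (inj₁ zu) =
        inj₁ (u , v , w , B.side⊆ (inj₁ zu) , B.side⊆ (Z.nbr zu uv) , B.side⊆ (Z.nbr zu uw) , uv , vw , uw)
      triangle-around u v w uv uw vw (inj₂ wu) =
        inj₂ (u , v , w , B′.side⊆ (inj₁ wu) , B′.side⊆ (W.nbr wu uv) , B′.side⊆ (W.nbr wu uw) , uv , vw , uw)

    triangle-split : Triangle G (Whole G) → Triangle G B.vertices ⊎ Triangle G B′.vertices
    triangle-split (u , v , w , _ , _ , _ , uv , vw , uw) with InSep? G a b u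
    ... | no u∉ = triangle-around u v w uv uw vw (Z⊎W G S u∉)
    ... | yes u∈ = triangle-around v u w (adj-sym G uv) vw uw (Z⊎W G S v∉)
      where
      v∉ : ¬ InSep G a b v
      v∉ v∈ = InSep-nonadj G S u∈ v∈ (λ u≡v → adj-irrefl G (subst (Adj G u) (sym u≡v) uv)) uv

    module _ (col₁ : Fin n → Bool) (proper₁ : ∀ u v → B.vertices u → B.vertices v → Adj G u v → col₁ u ≢ col₁ v)
             (col₂ : Fin n → Bool) (proper₂ : ∀ u v → B′.vertices u → B′.vertices v → Adj G u v → col₂ u ≢ col₂ v) where
      private
        Q = B.path
        d = col₁ a xor col₂ a
        -- Both colourings are proper on the block path, so they differ by a constant along it.
        twist : Fin n → Bool
        twist v = col₁ v xor col₂ v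

        Q⊆B′ : ∀ {k} → k ≤ len Q → B′.vertices (pAt G Q k)
        Q⊆B′ {zero} _ = B′.side⊆ (inj₂ (inj₁ B.path-start))
        Q⊆B′ {suc k} k+1≤ with m≤n⇒m<n∨m≡n k+1≤
        ... | inj₁ k+1< = B′.side⊆ (inj₁ (B.path-inner z<s k+1<))
        ... | inj₂ refl = B′.side⊆ (inj₂ (inj₂ B.path-end))

        twist-along : ∀ k → k ≤ len Q → twist (pAt G Q k) ≡ twist a
        twist-along zero _ = cong twist B.path-start
        twist-along (suc k) k< = begin
          col₁ v xor col₂ v                    ≡⟨ cong₂ _xor_ (¬-not (proper₁ v u (B.path⊆ k<) (B.path⊆ (<⇒≤ k<)) (adj-sym G uv)))
                                                              (¬-not (proper₂ v u (Q⊆B′ k<) (Q⊆B′ (<⇒≤ k<)) (adj-sym G uv))) ⟩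
          not (col₁ u) xor not (col₂ u)        ≡⟨ xor-not (col₁ u) (col₂ u) ⟩
          twist u                              ≡⟨ twist-along k (<⇒≤ k<) ⟩
          twist a                              ∎
          where
          open ≡-Reasoning
          u = pAt G Q k
          v = pAt G Q (suc k)
          uv = pAt-step G Q k<

        agree : ∀ {v} → InSep G a b v → d xor col₂ v ≡ col₁ v
        agree {v} v∈ = begin
          (col₁ a xor col₂ a) xor col₂ v   ≡⟨ cong (λ t → t xor col₂ v) (twist-sep v∈) ⟨
          (col₁ v xor col₂ v) xor col₂ v   ≡⟨ xor-assoc (col₁ v) (col₂ v) (col₂ v) ⟩
          col₁ v xor (col₂ v xor col₂ v)   ≡⟨ cong (col₁ v xor_) (xor-same (col₂ v)) ⟩
          col₁ v xor false                 ≡⟨ xor-identityʳ (col₁ v) ⟩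
          col₁ v                           ∎
          where
          open ≡-Reasoning
          twist-sep : ∀ {v} → InSep G a b v → twist v ≡ twist a
          twist-sep (inj₁ refl) = refl
          twist-sep (inj₂ refl) = trans (cong twist (sym B.path-end)) (twist-along (len Q) ≤-refl)

        col : Fin n → Bool
        col v with W.dec v
        ... | yes _ = d xor col₂ v
        ... | no _ = col₁ v

        col-W : ∀ {v} → W v → col v ≡ d xor col₂ v
        col-W {v} wv with W.dec v
        ... | yes _ = refl
        ... | no w∉ = ⊥-elim (w∉ wv)

        col-¬W : ∀ {v} → ¬ W v → col v ≡ col₁ v
        col-¬W {v} w∉ with W.dec v
        ... | yes wv = ⊥-elim (w∉ wv)
        ... | no _ = refl

        W-edge : ∀ {u v} → W u → ¬ W v → Adj G u v → col u ≢ col v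
        W-edge {u} {v} wu w∉v uv eq with W.nbr wu uv
        ... | inj₁ wv = w∉v wv
        ... | inj₂ v∈ = proper₂ u v (B′.side⊆ (inj₁ wu)) (B′.side⊆ (inj₂ v∈)) uv
                          (xor-injective d (trans (sym (col-W wu)) (trans eq (trans (col-¬W w∉v) (sym (agree v∈))))))

      bipartite-combine : Bipartite G (Whole G)
      bipartite-combine = col , proper
        where
        proper : ∀ u v → Whole G u → Whole G v → Adj G u v → col u ≢ col v
        proper u v _ _ uv = edge (W.dec u) (W.dec v)
          where
          edge : Dec (W u) → Dec (W v) → col u ≢ col v
          edge (yes wu) (yes wv) eq = proper₂ u v (B′.side⊆ (inj₁ wu)) (B′.side⊆ (inj₁ wv)) uv
                                        (xor-injective d (trans (sym (col-W wu)) (trans eq (col-W wv))))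
          edge (yes wu) (no w∉v) = W-edge wu w∉v uv
          edge (no w∉u) (yes wv) eq = W-edge wv w∉u (adj-sym G uv) (sym eq)
          edge (no w∉u) (no w∉v) eq = proper₁ u v (B.side⊆ (Z.within w∉u)) (B.side⊆ (Z.within w∉v)) uv
                                        (trans (sym (col-¬W w∉u)) (trans eq (col-¬W w∉v)))

-- Splicing a path through a block

module _ {n : ℕ} (G : Graph n) {a b Z W} (S : Separation G a b Z W) where
  private
    module W = Side G (swapSep G S)
    open Separation S

  record Run (R : Path G) : Set where
    field
      i j   : ℕ
      i<j   : i < j
      j≤    : j ≤ len R
      sep-i : InSep G a b (pAt G R i)
      sep-j : InSep G a b (pAt G R j)
      inner : ∀ {l} → i < l → l < j → W (pAt G R l)

    i≤ : i ≤ len R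
    i≤ = <⇒≤ (<-≤-trans i<j j≤)

    i≢j : pAt G R i ≢ pAt G R j
    i≢j eq = <⇒≢ i<j (pAt-injective G R i≤ j≤ eq)

    i+1<j : suc i < j
    i+1<j with m≤n⇒m<n∨m≡n i<j
    ... | inj₁ lt = lt
    ... | inj₂ i+1≡j = ⊥-elim (InSep-nonadj G S sep-i sep-j i≢j
                            (subst (λ l → Adj G (pAt G R i) (pAt G R l)) i+1≡j (pAt-step G R (subst (_≤ len R) (sym i+1≡j) j≤))))

    sep-only : ∀ {l} → l ≤ len R → InSep G a b (pAt G R l) → l ≡ i ⊎ l ≡ j
    sep-only l≤ l∈ = Sum.map (pAt-injective G R l≤ i≤) (pAt-injective G R l≤ j≤) (InSep-third G sep-i sep-j i≢j l∈)

  run-through : ∀ R {k} → k ≤ len R → W (pAt G R k) → ¬ W (pAt G R 0) → ¬ W (pAt G R (len R))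
              → Σ (Run R) λ ρ → Run.i ρ < k × k < Run.j ρ
  run-through R {k} k≤ wₖ w∉₀ w∉ₗ
    with W.exit-before (pAt G R) k wₖ w∉₀ (λ l< → pAt-step G R (<-≤-trans l< k≤))
       | W.exit-after (pAt G R) (len R ∸ k) k wₖ (subst (λ l → ¬ W (pAt G R l)) (sym (m+[n∸m]≡n k≤)) w∉ₗ)
                      (λ l< → pAt-step G R (subst (_ <_) (m+[n∸m]≡n k≤) l<))
  ... | i , i<k , sep-i , before | j , k<j , j≤ , sep-j , after = record
    { i = i ; j = j ; i<j = <-trans i<k k<j ; j≤ = subst (j ≤_) (m+[n∸m]≡n k≤) j≤
    ; sep-i = sep-i ; sep-j = sep-j ; inner = inner } , i<k , k<j
    where
    inner : ∀ {l} → i < l → l < j → W (pAt G R l)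
    inner {l} i<l l<j with ≤⊎> l k
    ... | inj₁ l≤k = before i<l l≤k
    ... | inj₂ k<l = after (<⇒≤ k<l) l<j

  run-unique : ∀ {R} (ρ : Run R) → ¬ W (pAt G R 0) → ¬ W (pAt G R (len R))
             → ∀ {l} → l ≤ len R → l ≤ Run.i ρ ⊎ Run.j ρ ≤ l → ¬ W (pAt G R l)
  run-unique {R} ρ w∉₀ w∉ₗ l≤ outside wₗ with run-through R l≤ wₗ w∉₀ w∉ₗ
  ... | ρ′ , i′<l , l<j′ with outside
  ...   | inj₁ l≤i = [ (λ i′≡i → <⇒≢ (<-≤-trans i′<l l≤i) i′≡i) , (λ i′≡j → <⇒≢ (<-trans (<-≤-trans i′<l l≤i) (Run.i<j ρ)) i′≡j) ]′
                       (Run.sep-only ρ (Run.i≤ ρ′) (Run.sep-i ρ′))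
  ...   | inj₂ j≤l = [ (λ j′≡i → <⇒≢ (<-trans (Run.i<j ρ) (≤-<-trans j≤l l<j′)) (sym j′≡i)) , (λ j′≡j → <⇒≢ (≤-<-trans j≤l l<j′) (sym j′≡j)) ]′
                       (Run.sep-only ρ (Run.j≤ ρ′) (Run.sep-j ρ′))

module Splice {n : ℕ} (G : Graph n) {a b Z W} (D : Block G a b Z W) (R : Path G) (ρ : Run G (Block.sep D) R)
              (only-run : ∀ {l} → l ≤ len R → l ≤ Run.i ρ ⊎ Run.j ρ ≤ l → ¬ W (pAt G R l)) where
  open Block D
  open Separation sep
  open Run ρ
  private
    module W = Side G (swapSep G sep)
    σ : Route G D (pAt G R i) (pAt G R j)
    σ = mkRoute G D (InSep-ends G sep-i sep-j i≢j)
    open Route σ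
    t = len route

    outside-Z : ∀ {l} → l ≤ len R → l < i ⊎ j < l → Z (pAt G R l)
    outside-Z l≤ out = W.other (only-run l≤ (Sum.map <⇒≤ <⇒≤ out)) (λ l∈ → [ (λ l≡i → [ (λ l<i → <⇒≢ l<i l≡i) , (λ j<l → <⇒≢ (<-trans i<j j<l) (sym l≡i)) ]′ out)
                                                                      , (λ l≡j → [ (λ l<i → <⇒≢ (<-trans l<i i<j) l≡j) , (λ j<l → <⇒≢ j<l (sym l≡j)) ]′ out) ]′
                                                                      (sep-only l≤ l∈))

    prefix : Path G
    prefix = subpath G R z≤n i≤

    first : Concatenable G prefix route
    first = record
      { meet = trans (pAt-subpath G R z≤n i≤ ≤-refl) (sym route-start)
      ; disjoint = disjoint′
      ; nonadjacent = nonadjacent′ }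
      where
      disjoint′ : ∀ {k k′} → k < i → 0 < k′ → k′ ≤ t → pAt G prefix k ≢ pAt G route k′
      disjoint′ {k} k<i 0<k′ k′≤ eq with m≤n⇒m<n∨m≡n k′≤
      ... | inj₁ k′<t = only-run (≤-trans (<⇒≤ k<i) i≤) (inj₁ (<⇒≤ k<i))
                          (subst W (sym (trans (sym (pAt-subpath G R z≤n i≤ (<⇒≤ k<i))) eq)) (route-inner 0<k′ k′<t))
      ... | inj₂ refl = <⇒≢ (<-trans k<i i<j) (pAt-injective G R (≤-trans (<⇒≤ k<i) i≤) j≤
                          (trans (sym (pAt-subpath G R z≤n i≤ (<⇒≤ k<i))) (trans eq route-end)))
      nonadjacent′ : ∀ {k k′} → k < i → 0 < k′ → k′ ≤ t → ¬ Adj G (pAt G prefix k) (pAt G route k′)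
      nonadjacent′ {k} k<i 0<k′ k′≤ adj with m≤n⇒m<n∨m≡n k′≤
      ... | inj₁ k′<t = Z≁W (subst Z (sym (pAt-subpath G R z≤n i≤ (<⇒≤ k<i))) (outside-Z (≤-trans (<⇒≤ k<i) i≤) (inj₁ k<i)))
                            (route-inner 0<k′ k′<t) adj
      ... | inj₂ refl with pAt-consec G R (≤-trans (<⇒≤ k<i) i≤) j≤ (subst₂ (Adj G) (pAt-subpath G R z≤n i≤ (<⇒≤ k<i)) route-end adj)
      ...   | inj₁ k+1≡j = <⇒≢ (≤-<-trans (s≤s (<⇒≤ k<i)) i+1<j) k+1≡j
      ...   | inj₂ j+1≡k = <⇒≱ (<-trans k<i i<j) (≤-trans (n≤1+n j) (≤-reflexive j+1≡k))

    middle : Path G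
    middle = concat G first

    suffix : Path G
    suffix = subpath G R j≤ ≤-refl

    suffix-at : ∀ {l} → l ≤ len R ∸ j → pAt G suffix l ≡ pAt G R (j + l)
    suffix-at = pAt-subpath G R j≤ ≤-refl

    j+l≤ : ∀ {l} → l ≤ len R ∸ j → j + l ≤ len R
    j+l≤ l≤ = ≤-trans (+-monoʳ-≤ j l≤) (≤-reflexive (m+[n∸m]≡n j≤))

    middle-prefix : ∀ {k} → k ≤ i → pAt G middle k ≡ pAt G R k
    middle-prefix k≤i = trans (pAt-concatˡ G first k≤i) (pAt-subpath G R z≤n i≤ k≤i)

    second : Concatenable G middle suffix
    second = record
      { meet = trans (pAt-concatʳ G first ≤-refl) (trans route-end (trans (cong (pAt G R) (sym (+-identityʳ j))) (sym (suffix-at z≤n))))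
      ; disjoint = disjoint′
      ; nonadjacent = nonadjacent′ }
      where
      disjoint′ : ∀ {k k′} → k < i + t → 0 < k′ → k′ ≤ len R ∸ j → pAt G middle k ≢ pAt G suffix k′
      disjoint′ {k} {k′} k< 0<k′ k′≤ = by-position k< (≤⊎+ i k)
        where
        by-position : ∀ {k} → k < i + t → k ≤ i ⊎ ∃[ l ] (0 < l × k ≡ i + l) → pAt G middle k ≢ pAt G suffix k′
        by-position _ (inj₁ k≤i) eq = <⇒≱ (<-≤-trans i<j (m≤m+n j k′))
          (≤-trans (≤-reflexive (sym (pAt-injective G R (≤-trans k≤i i≤) (j+l≤ k′≤)
                                       (trans (sym (middle-prefix k≤i)) (trans eq (suffix-at k′≤)))))) k≤i)
        by-position k< (inj₂ (l , 0<l , refl)) eq = only-run (j+l≤ k′≤) (inj₂ (m≤m+n j k′))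
          (subst W (trans (sym (pAt-concatʳ G first (<⇒≤ l<t))) (trans eq (suffix-at k′≤))) (route-inner 0<l l<t))
          where l<t = +-cancelˡ-< i l t k<

      nonadjacent′ : ∀ {k k′} → k < i + t → 0 < k′ → k′ ≤ len R ∸ j → ¬ Adj G (pAt G middle k) (pAt G suffix k′)
      nonadjacent′ {k} k< 0<k′ k′≤ = by-position k< (≤⊎+ i k)
        where
        by-position : ∀ {k} → k < i + t → k ≤ i ⊎ ∃[ l ] (0 < l × k ≡ i + l) → ¬ Adj G (pAt G middle k) (pAt G suffix _)
        by-position _ (inj₁ k≤i) adj with pAt-consec G R (≤-trans k≤i i≤) (j+l≤ k′≤) (subst₂ (Adj G) (middle-prefix k≤i) (suffix-at k′≤) adj)
        ... | inj₁ k+1≡ = <⇒≢ (≤-<-trans (s≤s k≤i) (<-≤-trans i+1<j (m≤m+n j _))) k+1≡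
        ... | inj₂ j+k′+1≡k = <⇒≱ (≤-<-trans k≤i (<-≤-trans i<j (m≤m+n j _))) (≤-trans (n≤1+n _) (≤-reflexive j+k′+1≡k))
        by-position k< (inj₂ (l , 0<l , refl)) adj =
          Z≁W (subst Z (sym (suffix-at k′≤)) (outside-Z (j+l≤ k′≤) (inj₂ (m<m+n j 0<k′)))) (route-inner 0<l l<t)
              (adj-sym G (subst (λ v → Adj G v (pAt G suffix _)) (pAt-concatʳ G first (<⇒≤ l<t)) adj))
          where l<t = +-cancelˡ-< i l t k<

  spliced : Path G
  spliced = concat G second

  spliced-prefix : ∀ {k} → k ≤ i → pAt G spliced k ≡ pAt G R k
  spliced-prefix k≤i = trans (pAt-concatˡ G second (≤-trans k≤i (m≤m+n i t))) (middle-prefix k≤i)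

  spliced-route : ∀ {l} → l ≤ t → pAt G spliced (i + l) ≡ pAt G route l
  spliced-route l≤ = trans (pAt-concatˡ G second (+-monoʳ-≤ i l≤)) (pAt-concatʳ G first l≤)

  spliced-suffix : ∀ {l} → l ≤ len R ∸ j → pAt G spliced (i + t + l) ≡ pAt G R (j + l)
  spliced-suffix l≤ = trans (pAt-concatʳ G second l≤) (suffix-at l≤)

  spliced-start : pAt G spliced 0 ≡ pAt G R 0
  spliced-start = spliced-prefix z≤n

  spliced-end : pAt G spliced (len spliced) ≡ pAt G R (len R)
  spliced-end = trans (spliced-suffix ≤-refl) (cong (pAt G R) (m+[n∸m]≡n j≤))

  spliced-long : 2 ≤ len spliced
  spliced-long = ≤-trans route-long (≤-trans (m≤n+m t i) (m≤m+n (i + t) _))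

  data Origin (k : ℕ) : Set where
    old : ∀ l → l ≤ len R → l ≤ i ⊎ j ≤ l → pAt G spliced k ≡ pAt G R l
        → (k ≡ 0 ⇔ l ≡ 0) → (k ≡ len spliced ⇔ l ≡ len R) → Origin k
    new : 0 < k → k < len spliced → W (pAt G spliced k) → vertices (pAt G spliced k) → Origin k

  private
    i<len : i < len spliced
    i<len = <-≤-trans (m<m+n i (≤-trans (s≤s z≤n) route-long)) (m≤m+n (i + t) _)

    from-prefix : ∀ {k} → k ≤ i → Origin k
    from-prefix {k} k≤i = old k (≤-trans k≤i i≤) (inj₁ k≤i) (spliced-prefix k≤i) (mk⇔ id id)
      (mk⇔ (λ k≡ → ⊥-elim (<⇒≱ (≤-<-trans k≤i i<len) (≤-reflexive (sym k≡))))
           (λ k≡ → ⊥-elim (<⇒≱ (<-≤-trans (≤-<-trans k≤i i<j) j≤) (≤-reflexive (sym k≡)))))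

    from-route : ∀ {l} → 0 < l → l < t → Origin (i + l)
    from-route {l} 0<l l<t = new (≤-trans 0<l (m≤n+m l i)) (<-≤-trans (+-monoʳ-< i l<t) (m≤m+n (i + t) _))
      (subst W (sym (spliced-route (<⇒≤ l<t))) (route-inner 0<l l<t))
      (subst vertices (sym (spliced-route (<⇒≤ l<t))) (route⊆ (<⇒≤ l<t)))

    from-suffix : ∀ {l} → l ≤ len R ∸ j → Origin (i + t + l)
    from-suffix {l} l≤ = old (j + l) (j+l≤ l≤) (inj₂ (m≤m+n j l)) (spliced-suffix l≤)
      (mk⇔ (λ k≡0 → ⊥-elim (<⇒≢ (≤-trans (s≤s z≤n) (≤-trans route-long (≤-trans (m≤n+m t i) (m≤m+n (i + t) l)))) (sym k≡0)))
           (λ j+l≡0 → ⊥-elim (<⇒≢ (<-≤-trans (≤-<-trans z≤n i<j) (m≤m+n j l)) (sym j+l≡0))))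
      (mk⇔ (λ k≡ → trans (cong (j +_) (+-cancelˡ-≡ (i + t) l _ k≡)) (m+[n∸m]≡n j≤))
           (λ j+l≡ → cong (i + t +_) (trans (sym (m+n∸m≡n j l)) (cong (_∸ j) j+l≡))))

  origin : ∀ {k} → k ≤ len spliced → Origin k
  origin {k} k≤ with ≤⊎+ i k
  ... | inj₁ k≤i = from-prefix k≤i
  ... | inj₂ (l , 0<l , refl) with ≤⊎> t l
  ...   | inj₂ l<t = from-route 0<l l<t
  ...   | inj₁ t≤l = subst Origin (sym reassoc) (from-suffix (+-cancelˡ-≤ (i + t) _ _ (subst (_≤ len spliced) reassoc k≤)))
    where
    reassoc : i + l ≡ i + t + (l ∸ t)
    reassoc = trans (cong (i +_) (sym (m+[n∸m]≡n t≤l))) (sym (+-assoc i t (l ∸ t)))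

  spliced⊆ : ∀ {k} → k ≤ len spliced → vertices (pAt G spliced k)
  spliced⊆ k≤ = from-origin (origin k≤)
    where
    side : ∀ {l} → l ≤ len R → l ≤ i ⊎ j ≤ l → _∪ab G Z a b (pAt G R l)
    side l≤ (inj₁ l≤i) with m≤n⇒m<n∨m≡n l≤i
    ... | inj₁ l<i = inj₁ (outside-Z l≤ (inj₁ l<i))
    ... | inj₂ refl = inj₂ sep-i
    side l≤ (inj₂ j≤l) with m≤n⇒m<n∨m≡n j≤l
    ... | inj₁ j<l = inj₁ (outside-Z l≤ (inj₂ j<l))
    ... | inj₂ refl = inj₂ sep-j
    from-origin : ∀ {k} → Origin k → vertices (pAt G spliced k)
    from-origin (new _ _ _ in-D) = in-D
    from-origin (old l l≤ outside eq _ _) = subst vertices (sym eq) (side⊆ (side l≤ outside))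

  inner-origin : ∀ {k} → 0 < k → k < len spliced → (∃[ l ] (0 < l × l < len R × pAt G spliced k ≡ pAt G R l)) ⊎ W (pAt G spliced k)
  inner-origin {k} 0<k k< = from-origin (origin (<⇒≤ k<))
    where
    from-origin : Origin k → (∃[ l ] (0 < l × l < len R × pAt G spliced k ≡ pAt G R l)) ⊎ W (pAt G spliced k)
    from-origin (new _ _ w _) = inj₂ w
    from-origin (old l l≤ _ eq at-0 at-len) =
      inj₁ (l , n≢0⇒n>0 (λ l≡0 → <⇒≢ 0<k (sym (from at-0 l≡0))) , ≤∧≢⇒< l≤ (λ l≡ → <⇒≢ k< (from at-len l≡)) , eq)

-- Thetas

the-others : (κ : Fin 3) → ∃₂ λ κ₁ κ₂ → κ₁ ≢ κ × κ₂ ≢ κ × (∀ κ′ → κ′ ≡ κ ⊎ κ′ ≡ κ₁ ⊎ κ′ ≡ κ₂)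
the-others fzero = fsuc fzero , fsuc (fsuc fzero) , (λ ()) , (λ ()) ,
  λ { fzero → inj₁ refl ; (fsuc fzero) → inj₂ (inj₁ refl) ; (fsuc (fsuc fzero)) → inj₂ (inj₂ refl) }
the-others (fsuc fzero) = fzero , fsuc (fsuc fzero) , (λ ()) , (λ ()) ,
  λ { fzero → inj₂ (inj₁ refl) ; (fsuc fzero) → inj₁ refl ; (fsuc (fsuc fzero)) → inj₂ (inj₂ refl) }
the-others (fsuc (fsuc fzero)) = fzero , fsuc fzero , (λ ()) , (λ ()) ,
  λ { fzero → inj₂ (inj₁ refl) ; (fsuc fzero) → inj₂ (inj₂ refl) ; (fsuc (fsuc fzero)) → inj₁ refl }

module _ {n : ℕ} (G : Graph n) where

  private
    which : ∀ {a b v} → InSep G a b v → Fin 2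
    which (inj₁ _) = fzero
    which (inj₂ _) = fsuc fzero

    which-injective : ∀ {a b u v} (u∈ : InSep G a b u) (v∈ : InSep G a b v) → which u∈ ≡ which v∈ → u ≡ v
    which-injective (inj₁ refl) (inj₁ refl) _ = refl
    which-injective (inj₂ refl) (inj₂ refl) _ = refl
    which-injective (inj₁ _) (inj₂ _) ()
    which-injective (inj₂ _) (inj₁ _) ()

  three-in-sep : ∀ {a b} (f : Fin 3 → Fin n) → (∀ κ → InSep G a b (f κ)) → (∀ {κ κ′} → κ ≢ κ′ → f κ ≢ f κ′) → ⊥
  three-in-sep f f∈ distinct with Fin.pigeonhole (s≤s (s≤s (s≤s z≤n))) (λ κ → which (f∈ κ))
  ... | κ , κ′ , κ<κ′ , same = distinct (Fin.<⇒≢ κ<κ′) (which-injective (f∈ κ) (f∈ κ′) same)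

  module _ (P : Fin 3 → Path G) (κ : Fin 3) (R : Path G) where
    private
      pick : ∀ κ′ → Dec (κ′ ≡ κ) → Path G
      pick _ (yes _) = R
      pick κ′ (no _) = P κ′

    replace : Fin 3 → Path G
    replace κ′ = pick κ′ (κ′ Fin.≟ κ)

    replace-each : (Q : Path G → Set) → Q R → (∀ {κ′} → κ′ ≢ κ → Q (P κ′)) → ∀ κ′ → Q (replace κ′)
    replace-each Q new old κ′ = go (κ′ Fin.≟ κ)
      where
      go : (d : Dec (κ′ ≡ κ)) → Q (pick κ′ d)
      go (yes _) = new
      go (no κ′≢κ) = old κ′≢κ

    replace-pairs : (Q : Path G → Path G → Set) → (∀ {κ₁ κ₂} → κ₁ ≢ κ₂ → Q (P κ₁) (P κ₂))
                  → (∀ {κ′} → κ′ ≢ κ → Q R (P κ′)) → (∀ {κ′} → κ′ ≢ κ → Q (P κ′) R)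
                  → ∀ κ₁ κ₂ → κ₁ ≢ κ₂ → Q (replace κ₁) (replace κ₂)
    replace-pairs Q old new-old old-new κ₁ κ₂ κ₁≢κ₂ = go (κ₁ Fin.≟ κ) (κ₂ Fin.≟ κ)
      where
      go : (d₁ : Dec (κ₁ ≡ κ)) (d₂ : Dec (κ₂ ≡ κ)) → Q (pick κ₁ d₁) (pick κ₂ d₂)
      go (yes refl) (yes refl) = ⊥-elim (κ₁≢κ₂ refl)
      go (yes refl) (no κ₂≢κ) = new-old κ₂≢κ
      go (no κ₁≢κ) (yes refl) = old-new κ₁≢κ
      go (no _) (no _) = old κ₁≢κ₂

  inner-pairs : ∀ {P₁ P₂ : Path G} (rel : Fin n → Fin n → Set)
              → (∀ {k l} → 0 < k → k < len P₁ → 0 < l → l < len P₂ → rel (pAt G P₁ k) (pAt G P₂ l))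
              → ∀ i j → Internal P₁ i → Internal P₂ j → rel (vx P₁ i) (vx P₂ j)
  inner-pairs {P₁} {P₂} rel holds i j (0<i , i<) (0<j , j<) = subst₂ rel (pAt-vx G P₁ i) (pAt-vx G P₂ j) (holds 0<i i< 0<j j<)

  module ThetaPaths (θ : Theta G (Whole G)) where
    open Theta θ

    theta-start : ∀ κ → pAt G (tP κ) 0 ≡ ta
    theta-start κ = trans (pAt-start G (tP κ)) (proj₁ (tends κ))

    theta-end : ∀ κ → pAt G (tP κ) (len (tP κ)) ≡ tb
    theta-end κ = trans (pAt-end G (tP κ)) (proj₂ (tends κ))

    module _ {κ κ′ : Fin 3} (κ≢κ′ : κ ≢ κ′) {l l′ : ℕ} (0<l : 0 < l) (l< : l < len (tP κ)) where

      theta-disjoint : 0 < l′ → l′ < len (tP κ′) → pAt G (tP κ) l ≢ pAt G (tP κ′) l′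
      theta-disjoint 0<l′ l′< = tdisj _ _ _ _ κ≢κ′ (interior G (tP κ) 0<l l<) (interior G (tP κ′) 0<l′ l′<)

      theta-nonadjacent : 0 < l′ → l′ < len (tP κ′) → ¬ Adj G (pAt G (tP κ) l) (pAt G (tP κ′) l′)
      theta-nonadjacent 0<l′ l′< = tnoedge _ _ _ _ κ≢κ′ (interior G (tP κ) 0<l l<) (interior G (tP κ′) 0<l′ l′<)

      theta-inner-not-on : l′ ≤ len (tP κ′) → pAt G (tP κ) l ≢ pAt G (tP κ′) l′
      theta-inner-not-on l′≤ eq with l′ ≟ 0 | m≤n⇒m<n∨m≡n l′≤
      ... | yes refl | _ = <⇒≢ 0<l (sym (pAt-injective G (tP κ) (<⇒≤ l<) z≤n (trans eq (trans (theta-start κ′) (sym (theta-start κ))))))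
      ... | no l′≢0 | inj₁ l′< = theta-disjoint (n≢0⇒n>0 l′≢0) l′< eq
      ... | no _ | inj₂ refl = <⇒≢ l< (pAt-injective G (tP κ) (<⇒≤ l<) ≤-refl (trans eq (trans (theta-end κ′) (sym (theta-end κ)))))

    theta-inner≢start : ∀ κ {l} → 0 < l → l < len (tP κ) → pAt G (tP κ) l ≢ ta
    theta-inner≢start κ 0<l l< eq = <⇒≢ 0<l (sym (pAt-injective G (tP κ) (<⇒≤ l<) z≤n (trans eq (sym (theta-start κ)))))

    theta-inner≢end : ∀ κ {l} → 0 < l → l < len (tP κ) → pAt G (tP κ) l ≢ tb
    theta-inner≢end κ 0<l l< eq = <⇒≢ l< (pAt-injective G (tP κ) (<⇒≤ l<) ≤-refl (trans eq (sym (theta-end κ))))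

  module ThetaSplice {a b Z W} (D : Block G a b Z W) (θ : Theta G (Whole G)) (κ : Fin 3) (ρ : Run G (Block.sep D) (Theta.tP θ κ))
                     (only-run : ∀ κ′ {l} → l ≤ len (Theta.tP θ κ′) → (κ′ ≡ κ → l ≤ Run.i ρ ⊎ Run.j ρ ≤ l)
                               → ¬ W (pAt G (Theta.tP θ κ′) l)) where
    open Theta θ
    open ThetaPaths θ
    open Block D
    open Separation sep
    open Run ρ
    private
      module Z = Side G sep
      module W = Side G (swapSep G sep)
      R = tP κ
      module Sp = Splice G D R ρ (λ l≤ out → only-run κ l≤ (λ _ → out))
      R′ = Sp.spliced

      other-Z : ∀ {κ′} → κ′ ≢ κ → ∀ {l} → 0 < l → l < len (tP κ′) → Z (pAt G (tP κ′) l)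
      other-Z {κ′} κ′≢κ {l} 0<l l< = W.other (only-run κ′ (<⇒≤ l<) (λ κ′≡κ → ⊥-elim (κ′≢κ κ′≡κ))) not-sep
        where
        κ≢κ′ = λ κ≡κ′ → κ′≢κ (sym κ≡κ′)
        at-end : ∀ {e} → e ≤ len R → pAt G (tP κ′) l ≢ pAt G R e
        at-end {e} e≤ with e ≟ 0 | m≤n⇒m<n∨m≡n e≤
        ... | yes refl | _ = λ eq → theta-inner≢start κ′ 0<l l< (trans eq (theta-start κ))
        ... | no e≢0 | inj₁ e< = λ eq → theta-inner-not-on κ≢κ′ (n≢0⇒n>0 e≢0) e< (<⇒≤ l<) (sym eq)
        ... | no _ | inj₂ refl = λ eq → theta-inner≢end κ′ 0<l l< (trans eq (theta-end κ))
        not-sep : ¬ InSep G a b (pAt G (tP κ′) l)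
        not-sep l∈ = [ at-end i≤ , at-end j≤ ]′ (InSep-third G sep-i sep-j i≢j l∈)

      spliced-vs-other : ∀ {κ′} → κ′ ≢ κ → ∀ {k l} → 0 < k → k < len R′ → 0 < l → l < len (tP κ′)
                       → pAt G R′ k ≢ pAt G (tP κ′) l × ¬ Adj G (pAt G R′ k) (pAt G (tP κ′) l)
      spliced-vs-other {κ′} κ′≢κ {k} {l} 0<k k< 0<l l< = by-origin (Sp.inner-origin 0<k k<)
        where
        κ≢κ′ = λ κ≡κ′ → κ′≢κ (sym κ≡κ′)
        by-origin : (∃[ l′ ] (0 < l′ × l′ < len R × pAt G R′ k ≡ pAt G R l′)) ⊎ W (pAt G R′ k)
                  → pAt G R′ k ≢ pAt G (tP κ′) l × ¬ Adj G (pAt G R′ k) (pAt G (tP κ′) l)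
        by-origin (inj₁ (l′ , 0<l′ , l′< , eq)) =
          (λ e → theta-disjoint κ≢κ′ 0<l′ l′< 0<l l< (trans (sym eq) e)) ,
          (λ adj → theta-nonadjacent κ≢κ′ 0<l′ l′< 0<l l< (subst (λ v → Adj G v _) eq adj))
        by-origin (inj₂ w) = (λ e → disjoint (other-Z κ′≢κ 0<l l<) (subst W e w)) , (λ adj → Z≁W (other-Z κ′≢κ 0<l l<) w (adj-sym G adj))

    spliced-theta : Theta G vertices
    spliced-theta = record
      { ta = ta ; tb = tb ; tnonadj = tnonadj ; tP = P′
      ; tends = replace-each tP κ R′ (λ Q → start Q ≡ ta × end Q ≡ tb)
                  (trans (sym (pAt-start G R′)) (trans Sp.spliced-start (theta-start κ)) ,
                   trans (sym (pAt-end G R′)) (trans Sp.spliced-end (theta-end κ))) (λ {κ′} _ → tends κ′)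
      ; tlen = replace-each tP κ R′ (λ Q → 2 ≤ len Q) Sp.spliced-long (λ {κ′} _ → tlen κ′)
      ; tdisj = λ κ₁ κ₂ i j κ₁≢κ₂ → replace-pairs tP κ R′ Disjoint (λ {κ₁} {κ₂} ne i j → tdisj κ₁ κ₂ i j ne)
                  (λ {κ′} κ′≢κ → inner-pairs {R′} {tP κ′} _≢_ (λ 0<k k< 0<l l< → proj₁ (spliced-vs-other κ′≢κ 0<k k< 0<l l<)))
                  (λ {κ′} κ′≢κ → inner-pairs {tP κ′} {R′} _≢_ (λ 0<k k< 0<l l< e → proj₁ (spliced-vs-other κ′≢κ 0<l l< 0<k k<) (sym e)))
                  κ₁ κ₂ κ₁≢κ₂ i j
      ; tnoedge = λ κ₁ κ₂ i j κ₁≢κ₂ → replace-pairs tP κ R′ Nonadjacent (λ {κ₁} {κ₂} ne i j → tnoedge κ₁ κ₂ i j ne)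
                  (λ {κ′} κ′≢κ → inner-pairs {R′} {tP κ′} (λ u v → ¬ Adj G u v) (λ 0<k k< 0<l l< → proj₂ (spliced-vs-other κ′≢κ 0<k k< 0<l l<)))
                  (λ {κ′} κ′≢κ → inner-pairs {tP κ′} {R′} (λ u v → ¬ Adj G u v) (λ 0<k k< 0<l l< adj → proj₂ (spliced-vs-other κ′≢κ 0<l l< 0<k k<) (adj-sym G adj)))
                  κ₁ κ₂ κ₁≢κ₂ i j
      ; tin = replace-each tP κ R′ (PathIn G vertices) (λ i → subst vertices (pAt-vx G R′ i) (Sp.spliced⊆ (Fin.toℕ≤pred[n] i)))
                (λ {κ′} κ′≢κ i → side⊆ (Z.within (λ w → only-run κ′ (Fin.toℕ≤pred[n] i) (λ κ′≡κ → ⊥-elim (κ′≢κ κ′≡κ))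
                                                              (subst W (sym (pAt-vx G (tP κ′) i)) w)))) }
      where
      P′ = replace tP κ R′
      Disjoint Nonadjacent : Path G → Path G → Set
      Disjoint P₁ P₂ = ∀ i j → Internal P₁ i → Internal P₂ j → vx P₁ i ≢ vx P₂ j
      Nonadjacent P₁ P₂ = ∀ i j → Internal P₁ i → Internal P₂ j → ¬ Adj G (vx P₁ i) (vx P₂ j)

  module ThetaSplit {a b Z W} (B : Block G a b Z W) (B′ : Block G a b W Z) (θ : Theta G (Whole G)) where
    open Theta θ
    open ThetaPaths θ
    private
      S = Block.sep B
      module B = Block B
      module B′ = Block B′
      module Z = Side G S
      module W = Side G (swapSep G S)
      open Separation S
      HasW : Fin 3 → Set
      HasW κ = ∃[ l ] W (vx (tP κ) l)
      HasW? : ∀ κ → Dec (HasW κ)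
      HasW? κ = Fin.any? (λ l → W.dec (vx (tP κ) l))
      W-at : ∀ {κ} → HasW κ → ∃[ l ] (l ≤ len (tP κ) × W (pAt G (tP κ) l))
      W-at {κ} (l , w) = toℕ l , Fin.toℕ≤pred[n] l , subst W (sym (pAt-vx G (tP κ) l)) w

    theta-without-W : (∀ κ → ¬ HasW κ) → Theta G B.vertices
    theta-without-W none = record
      { ta = ta ; tb = tb ; tnonadj = tnonadj ; tP = tP ; tends = tends ; tlen = tlen ; tdisj = tdisj ; tnoedge = tnoedge
      ; tin = λ κ l → B.side⊆ (Z.within (λ w → none κ (l , w))) }

    ends-apart : Z ta → W tb → ⊥
    ends-apart za wb = three-in-sep (λ κ → pAt G (tP κ) (pos κ)) (λ κ → proj₂ (proj₂ (proj₂ (sep-on κ))))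
                         (λ κ≢κ′ → theta-disjoint κ≢κ′ (0<pos _) (pos< _) (0<pos _) (pos< _))
      where
      sep-on : ∀ κ → ∃[ l ] (0 < l × l < len (tP κ) × InSep G a b (pAt G (tP κ) l))
      sep-on κ with W.exit-before (pAt G (tP κ)) (len (tP κ)) (subst W (sym (theta-end κ)) wb)
                        (λ w → disjoint (subst Z (sym (theta-start κ)) za) w) (pAt-step G (tP κ))
      ... | zero , _ , l∈ , _ = ⊥-elim (Z.∉sep za (subst (InSep G a b) (theta-start κ) l∈))
      ... | suc l , l< , l∈ , _ = suc l , z<s , l< , l∈
      pos : Fin 3 → ℕ
      pos κ = proj₁ (sep-on κ)
      0<pos : ∀ κ → 0 < pos κ
      0<pos κ = proj₁ (proj₂ (sep-on κ))
      pos< : ∀ κ → pos κ < len (tP κ)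
      pos< κ = proj₁ (proj₂ (proj₂ (sep-on κ)))

    module Core (w∉ta : ¬ W ta) (w∉tb : ¬ W tb) where
      private
        w∉start : ∀ κ → ¬ W (pAt G (tP κ) 0)
        w∉start κ w = w∉ta (subst W (theta-start κ) w)
        w∉end : ∀ κ → ¬ W (pAt G (tP κ) (len (tP κ)))
        w∉end κ w = w∉tb (subst W (theta-end κ) w)
        run-at : ∀ κ {l} → l ≤ len (tP κ) → W (pAt G (tP κ) l) → Run G S (tP κ)
        run-at κ l≤ w = proj₁ (run-through G S (tP κ) l≤ w (w∉start κ) (w∉end κ))

      splice-through-inner-sep : ∀ κ (ρ : Run G S (tP κ)) {m} → 0 < m → m < len (tP κ) → InSep G a b (pAt G (tP κ) m)
                               → Theta G B.vertices
      splice-through-inner-sep κ ρ {m} 0<m m< m∈ = ThetaSplice.spliced-theta B θ κ ρ only-run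
        where
        only-run : ∀ κ′ {l} → l ≤ len (tP κ′) → (κ′ ≡ κ → l ≤ Run.i ρ ⊎ Run.j ρ ≤ l) → ¬ W (pAt G (tP κ′) l)
        only-run κ′ l≤ in-run with κ′ Fin.≟ κ
        ... | yes refl = run-unique G S ρ (w∉start κ) (w∉end κ) l≤ (in-run refl)
        ... | no κ′≢κ = λ w → [ on-κ′ (Run.i≤ (ρ′ w)) , on-κ′ (Run.j≤ (ρ′ w)) ]′
                                (InSep-third G (Run.sep-i (ρ′ w)) (Run.sep-j (ρ′ w)) (Run.i≢j (ρ′ w)) m∈)
          where
          ρ′ = run-at κ′ l≤
          on-κ′ : ∀ {e} → e ≤ len (tP κ′) → pAt G (tP κ) m ≢ pAt G (tP κ′) e
          on-κ′ = theta-inner-not-on (λ κ≡κ′ → κ′≢κ (sym κ≡κ′)) 0<m m<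

      -- Then every path joins a to b, so its interior lies entirely in Z or entirely in W.
      module EndsInSep (κ : Fin 3) (ρ : Run G S (tP κ)) (i≡0 : Run.i ρ ≡ 0) (j≡len : Run.j ρ ≡ len (tP κ)) where
        private
          ta∈ : InSep G a b ta
          ta∈ = subst (InSep G a b) (trans (cong (pAt G (tP κ)) i≡0) (theta-start κ)) (Run.sep-i ρ)
          tb∈ : InSep G a b tb
          tb∈ = subst (InSep G a b) (trans (cong (pAt G (tP κ)) j≡len) (theta-end κ)) (Run.sep-j ρ)
          ta≢tb : ta ≢ tb
          ta≢tb eq = Run.i≢j ρ (trans (cong (pAt G (tP κ)) i≡0) (trans (theta-start κ) (trans eq
                       (sym (trans (cong (pAt G (tP κ)) j≡len) (theta-end κ))))))

          sep-at-ends : ∀ κ′ {x} → x ≤ len (tP κ′) → InSep G a b (pAt G (tP κ′) x) → x ≡ 0 ⊎ x ≡ len (tP κ′)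
          sep-at-ends κ′ x≤ x∈ = Sum.map (λ e → pAt-injective G (tP κ′) x≤ z≤n (trans e (sym (theta-start κ′))))
                                         (λ e → pAt-injective G (tP κ′) x≤ ≤-refl (trans e (sym (theta-end κ′))))
                                         (InSep-third G ta∈ tb∈ ta≢tb x∈)

          inner∉sep : ∀ κ′ {x} → 0 < x → x < len (tP κ′) → ¬ InSep G a b (pAt G (tP κ′) x)
          inner∉sep κ′ 0<x x< x∈ = [ (λ x≡0 → <⇒≢ 0<x (sym x≡0)) , <⇒≢ x< ]′ (sep-at-ends κ′ (<⇒≤ x<) x∈)

          InnerW InnerZ : Fin 3 → Set
          InnerW κ′ = ∀ {x} → 0 < x → x < len (tP κ′) → W (pAt G (tP κ′) x)
          InnerZ κ′ = ∀ {x} → 0 < x → x < len (tP κ′) → Z (pAt G (tP κ′) x)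

          inner-W : ∀ κ′ → HasW κ′ → InnerW κ′
          inner-W κ′ has {x} 0<x x< with W-at has
          ... | l , l≤ , w with run-at κ′ l≤ w
          ...   | ρ′ with sep-at-ends κ′ (Run.i≤ ρ′) (Run.sep-i ρ′) | sep-at-ends κ′ (Run.j≤ ρ′) (Run.sep-j ρ′)
          ...     | inj₂ i′≡len | _ = ⊥-elim (<⇒≱ (Run.i<j ρ′) (subst (Run.j ρ′ ≤_) (sym i′≡len) (Run.j≤ ρ′)))
          ...     | inj₁ i′≡0 | inj₁ j′≡0 = ⊥-elim (<⇒≢ (Run.i<j ρ′) (trans i′≡0 (sym j′≡0)))
          ...     | inj₁ i′≡0 | inj₂ j′≡len = Run.inner ρ′ (subst (_< x) (sym i′≡0) 0<x) (subst (x <_) (sym j′≡len) x<)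

          inner-Z : ∀ κ′ → ¬ HasW κ′ → InnerZ κ′
          inner-Z κ′ none {x} 0<x x< = W.other (λ w → none (clamp (len (tP κ′)) x , w)) (inner∉sep κ′ 0<x x<)

          inner-W-κ : InnerW κ
          inner-W-κ 0<x x< = Run.inner ρ (subst (_< _) (sym i≡0) 0<x) (subst (_ <_) (sym j≡len) x<)

          ends∉ : ∀ {Y : VSet G} → (∀ {v} → Y v → ¬ InSep G a b v) → ∀ κ′ {x} → x ≡ 0 ⊎ x ≡ len (tP κ′) → ¬ Y (pAt G (tP κ′) x)
          ends∉ Y∉ κ′ (inj₁ refl) y = Y∉ y (subst (InSep G a b) (sym (theta-start κ′)) ta∈)
          ends∉ Y∉ κ′ (inj₂ refl) y = Y∉ y (subst (InSep G a b) (sym (theta-end κ′)) tb∈)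

          Z∉inner-W : ∀ κ′ → InnerW κ′ → ∀ {x} → x ≤ len (tP κ′) → ¬ Z (pAt G (tP κ′) x)
          Z∉inner-W κ′ inner {x} x≤ z with x ≟ 0 | m≤n⇒m<n∨m≡n x≤
          ... | yes x≡0 | _ = ends∉ Z.∉sep κ′ (inj₁ x≡0) z
          ... | no _ | inj₂ x≡len = ends∉ Z.∉sep κ′ (inj₂ x≡len) z
          ... | no x≢0 | inj₁ x< = disjoint z (inner (n≢0⇒n>0 x≢0) x<)

          splice-Z-path : ∀ κ₂ → InnerZ κ₂ → (∀ {κ′} → κ′ ≢ κ₂ → InnerW κ′) → Theta G B′.vertices
          splice-Z-path κ₂ inner-Z₂ others-W = ThetaSplice.spliced-theta B′ θ κ₂ ρ₂ only-run
            where
            ρ₂ : Run G (Block.sep B′) (tP κ₂)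
            ρ₂ = record
              { i = 0 ; j = len (tP κ₂) ; i<j = ≤-trans (s≤s z≤n) (tlen κ₂) ; j≤ = ≤-refl
              ; sep-i = subst (InSep G a b) (sym (theta-start κ₂)) ta∈ ; sep-j = subst (InSep G a b) (sym (theta-end κ₂)) tb∈
              ; inner = inner-Z₂ }
            only-run : ∀ κ′ {l} → l ≤ len (tP κ′) → (κ′ ≡ κ₂ → l ≤ 0 ⊎ len (tP κ₂) ≤ l) → ¬ Z (pAt G (tP κ′) l)
            only-run κ′ l≤ at-ends with κ′ Fin.≟ κ₂
            ... | yes refl = ends∉ Z.∉sep κ₂ (Sum.map (λ l≤0 → ≤-antisym l≤0 z≤n) (≤-antisym l≤) (at-ends refl))
            ... | no κ′≢κ₂ = Z∉inner-W κ′ (others-W κ′≢κ₂) l≤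

          theta-in-B′ : (∀ κ′ → InnerW κ′) → Theta G B′.vertices
          theta-in-B′ all-W = record
            { ta = ta ; tb = tb ; tnonadj = tnonadj ; tP = tP ; tends = tends ; tlen = tlen ; tdisj = tdisj ; tnoedge = tnoedge
            ; tin = λ κ′ l → subst B′.vertices (pAt-vx G (tP κ′) l) (B′.side⊆ (side κ′ (Fin.toℕ≤pred[n] l))) }
            where
            side : ∀ κ′ {x} → x ≤ len (tP κ′) → _∪ab G W a b (pAt G (tP κ′) x)
            side κ′ {x} x≤ with x ≟ 0 | m≤n⇒m<n∨m≡n x≤
            ... | yes refl | _ = inj₂ (subst (InSep G a b) (sym (theta-start κ′)) ta∈)
            ... | no _ | inj₂ refl = inj₂ (subst (InSep G a b) (sym (theta-end κ′)) tb∈)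
            ... | no x≢0 | inj₁ x< = inj₁ (all-W κ′ (n≢0⇒n>0 x≢0) x<)

        theta-ends-in-sep : Theta G B.vertices ⊎ Theta G B′.vertices
        theta-ends-in-sep with the-others κ
        ... | κ₁ , κ₂ , κ₁≢κ , κ₂≢κ , cover with HasW? κ₁ | HasW? κ₂
        ...   | no free₁ | no free₂ = inj₁ (ThetaSplice.spliced-theta B θ κ ρ only-run)
          where
          only-run : ∀ κ′ {l} → l ≤ len (tP κ′) → (κ′ ≡ κ → l ≤ Run.i ρ ⊎ Run.j ρ ≤ l) → ¬ W (pAt G (tP κ′) l)
          only-run κ′ {l} l≤ at-ends with cover κ′
          ... | inj₁ refl = ends∉ W.∉sep κ (Sum.map (λ l≤i → ≤-antisym (subst (l ≤_) i≡0 l≤i) z≤n)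
                                                     (λ j≤l → ≤-antisym l≤ (subst (_≤ l) j≡len j≤l)) (at-ends refl))
          ... | inj₂ (inj₁ refl) = λ w → free₁ (clamp (len (tP κ₁)) l , w)
          ... | inj₂ (inj₂ refl) = λ w → free₂ (clamp (len (tP κ₂)) l , w)
        ...   | yes has₁ | yes has₂ = inj₂ (theta-in-B′ all-W)
          where
          all-W : ∀ κ′ → InnerW κ′
          all-W κ′ with cover κ′
          ... | inj₁ refl = inner-W-κ
          ... | inj₂ (inj₁ refl) = inner-W κ₁ has₁
          ... | inj₂ (inj₂ refl) = inner-W κ₂ has₂
        ...   | yes has₁ | no free₂ = inj₂ (splice-Z-path κ₂ (inner-Z κ₂ free₂) others-W)
          where
          others-W : ∀ {κ′} → κ′ ≢ κ₂ → InnerW κ′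
          others-W {κ′} κ′≢κ₂ with cover κ′
          ... | inj₁ refl = inner-W-κ
          ... | inj₂ (inj₁ refl) = inner-W κ₁ has₁
          ... | inj₂ (inj₂ refl) = ⊥-elim (κ′≢κ₂ refl)
        ...   | no free₁ | yes has₂ = inj₂ (splice-Z-path κ₁ (inner-Z κ₁ free₁) others-W)
          where
          others-W : ∀ {κ′} → κ′ ≢ κ₁ → InnerW κ′
          others-W {κ′} κ′≢κ₁ with cover κ′
          ... | inj₁ refl = inner-W-κ
          ... | inj₂ (inj₁ refl) = ⊥-elim (κ′≢κ₁ refl)
          ... | inj₂ (inj₂ refl) = inner-W κ₂ has₂

      theta-core : Theta G B.vertices ⊎ Theta G B′.vertices
      theta-core with Fin.any? HasW?
      ... | no none = inj₁ (theta-without-W (λ κ has → none (κ , has)))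
      ... | yes (κ , has) with W-at has
      ...   | l , l≤ , w with run-at κ l≤ w
      ...     | ρ with Run.i ρ ≟ 0 | Run.j ρ ≟ len (tP κ)
      ...       | no i≢0 | _ = inj₁ (splice-through-inner-sep κ ρ (n≢0⇒n>0 i≢0) (<-≤-trans (Run.i<j ρ) (Run.j≤ ρ)) (Run.sep-i ρ))
      ...       | yes _ | no j≢len = inj₁ (splice-through-inner-sep κ ρ (≤-<-trans z≤n (Run.i<j ρ)) (≤∧≢⇒< (Run.j≤ ρ) j≢len) (Run.sep-j ρ))
      ...       | yes i≡0 | yes j≡len = EndsInSep.theta-ends-in-sep κ ρ i≡0 j≡len

  module _ {a b Z W} (B : Block G a b Z W) (B′ : Block G a b W Z) (θ : Theta G (Whole G)) where
    open Theta θ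
    private
      open Separation (Block.sep B)
      module W = Side G (swapSep G (Block.sep B))
      core-Z : ¬ W ta → ¬ W tb → Theta G (Block.vertices B) ⊎ Theta G (Block.vertices B′)
      core-Z = ThetaSplit.Core.theta-core B B′ θ
      core-W : ¬ Z ta → ¬ Z tb → Theta G (Block.vertices B) ⊎ Theta G (Block.vertices B′)
      core-W z∉a z∉b = Sum.swap (ThetaSplit.Core.theta-core B′ B θ z∉a z∉b)

    theta-split : Theta G (Block.vertices B) ⊎ Theta G (Block.vertices B′)
    theta-split with W.dec ta | W.dec tb
    ... | no w∉a | no w∉b = core-Z w∉a w∉b
    ... | yes wa | yes wb = core-W (λ za → disjoint za wa) (λ zb → disjoint zb wb)
    ... | yes wa | no _ = core-W (λ za → disjoint za wa) (ThetaSplit.ends-apart B′ B θ wa)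
    ... | no _ | yes wb = core-W (λ za → ThetaSplit.ends-apart B B′ θ za wb) (λ zb → disjoint zb wb)

-- Prisms

AtEnds : ℕ → ℕ → ℕ → ℕ → Set
AtEnds k l k′ l′ = (k ≡ 0 × k′ ≡ 0) ⊎ (k ≡ l × k′ ≡ l′)

AtEnds-sym : ∀ {k l k′ l′} → AtEnds k l k′ l′ → AtEnds k′ l′ k l
AtEnds-sym = Sum.map swap swap

module _ {n : ℕ} (G : Graph n) where

  module PrismPaths (π : Prism G (Whole G)) where
    open Prism π

    module _ {κ κ′ : Fin 3} (κ≢κ′ : κ ≢ κ′) {k k′ : ℕ} (k≤ : k ≤ len (pP κ)) (k′≤ : k′ ≤ len (pP κ′)) where

      prism-disjoint : pAt G (pP κ) k ≢ pAt G (pP κ′) k′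
      prism-disjoint = pdisj _ _ _ _ κ≢κ′

      prism-adj⇔ : Adj G (pAt G (pP κ) k) (pAt G (pP κ′) k′) ⇔ AtEnds k (len (pP κ)) k′ (len (pP κ′))
      prism-adj⇔ = subst₂ (λ x y → Adj G (pAt G (pP κ) k) (pAt G (pP κ′) k′) ⇔ AtEnds x (len (pP κ)) y (len (pP κ′)))
                          (toℕ-clamp _ k≤) (toℕ-clamp _ k′≤) (pedges _ _ _ _ κ≢κ′)

  module PrismSplice {a b Z W} (D : Block G a b Z W) (π : Prism G (Whole G)) (κ : Fin 3) (ρ : Run G (Block.sep D) (Prism.pP π κ))
                     (only-run : ∀ κ′ {l} → l ≤ len (Prism.pP π κ′) → (κ′ ≡ κ → l ≤ Run.i ρ ⊎ Run.j ρ ≤ l)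
                               → ¬ W (pAt G (Prism.pP π κ′) l)) where
    open Prism π
    open PrismPaths π
    open Block D
    open Separation sep
    open Run ρ
    private
      module W = Side G (swapSep G sep)
      R = pP κ
      module Sp = Splice G D R ρ (λ l≤ out → only-run κ l≤ (λ _ → out))
      R′ = Sp.spliced

      other-Z : ∀ {κ′} → κ′ ≢ κ → ∀ {l} → l ≤ len (pP κ′) → Z (pAt G (pP κ′) l)
      other-Z {κ′} κ′≢κ {l} l≤ = W.other (only-run κ′ l≤ (λ κ′≡κ → ⊥-elim (κ′≢κ κ′≡κ)))
        (λ l∈ → [ (λ e → prism-disjoint (λ κ≡κ′ → κ′≢κ (sym κ≡κ′)) i≤ l≤ (sym e))
                , (λ e → prism-disjoint (λ κ≡κ′ → κ′≢κ (sym κ≡κ′)) j≤ l≤ (sym e)) ]′ (InSep-third G sep-i sep-j i≢j l∈))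

      module _ {κ′ : Fin 3} (κ′≢κ : κ′ ≢ κ) {k k′ : ℕ} (k≤ : k ≤ len R′) (k′≤ : k′ ≤ len (pP κ′)) where
        private
          κ≢κ′ = λ κ≡κ′ → κ′≢κ (sym κ≡κ′)

        spliced-disjoint : pAt G R′ k ≢ pAt G (pP κ′) k′
        spliced-disjoint = by-origin (Sp.origin k≤)
          where
          by-origin : Sp.Origin k → pAt G R′ k ≢ pAt G (pP κ′) k′
          by-origin (Sp.old l l≤ _ eq _ _) e = prism-disjoint κ≢κ′ l≤ k′≤ (trans (sym eq) e)
          by-origin (Sp.new _ _ w _) e = disjoint (other-Z κ′≢κ k′≤) (subst W e w)

        spliced-adj⇔ : Adj G (pAt G R′ k) (pAt G (pP κ′) k′) ⇔ AtEnds k (len R′) k′ (len (pP κ′))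
        spliced-adj⇔ = by-origin (Sp.origin k≤)
          where
          by-origin : Sp.Origin k → Adj G (pAt G R′ k) (pAt G (pP κ′) k′) ⇔ AtEnds k (len R′) k′ (len (pP κ′))
          by-origin (Sp.old l l≤ _ eq at-0 at-len) = mk⇔
            (λ adj → Sum.map (map₁ (from at-0)) (map₁ (from at-len)) (to old⇔ (subst (λ v → Adj G v _) eq adj)))
            (λ ends → subst (λ v → Adj G v _) (sym eq) (from old⇔ (Sum.map (map₁ (to at-0)) (map₁ (to at-len)) ends)))
            where old⇔ = prism-adj⇔ κ≢κ′ l≤ k′≤
          by-origin (Sp.new 0<k k< w _) = mk⇔
            (λ adj → ⊥-elim (Z≁W (other-Z κ′≢κ k′≤) w (adj-sym G adj)))
            [ (λ (k≡0 , _) → ⊥-elim (<⇒≢ 0<k (sym k≡0))) , (λ (k≡len , _) → ⊥-elim (<⇒≢ k< k≡len)) ]′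

    spliced-prism : Prism G vertices
    spliced-prism = record
      { pP = replace G pP κ R′
      ; plen = replace-each G pP κ R′ (λ Q → 1 ≤ len Q) (≤-trans (s≤s z≤n) Sp.spliced-long) (λ {κ′} _ → plen κ′)
      ; pdisj = λ κ₁ κ₂ i j κ₁≢κ₂ → replace-pairs G pP κ R′ Disjoint (λ {κ₁} {κ₂} ne i j → pdisj κ₁ κ₂ i j ne)
                  (λ {κ′} κ′≢κ i j → at-vx R′ (pP κ′) _≢_ i j (spliced-disjoint κ′≢κ (Fin.toℕ≤pred[n] i) (Fin.toℕ≤pred[n] j)))
                  (λ {κ′} κ′≢κ i j e → spliced-disjoint κ′≢κ (Fin.toℕ≤pred[n] j) (Fin.toℕ≤pred[n] i)
                                          (trans (pAt-vx G R′ j) (trans (sym e) (sym (pAt-vx G (pP κ′) i)))))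
                  κ₁ κ₂ κ₁≢κ₂ i j
      ; pedges = λ κ₁ κ₂ i j κ₁≢κ₂ → replace-pairs G pP κ R′ Edges (λ {κ₁} {κ₂} ne i j → pedges κ₁ κ₂ i j ne)
                   (λ {κ′} κ′≢κ i j → at-vx R′ (pP κ′) (λ u v → Adj G u v ⇔ AtEnds (toℕ i) (len R′) (toℕ j) (len (pP κ′))) i j
                                         (spliced-adj⇔ κ′≢κ (Fin.toℕ≤pred[n] i) (Fin.toℕ≤pred[n] j)))
                   (λ {κ′} κ′≢κ i j → at-vx (pP κ′) R′ (λ u v → Adj G u v ⇔ AtEnds (toℕ i) (len (pP κ′)) (toℕ j) (len R′)) i j
                                         (flip⇔ (spliced-adj⇔ κ′≢κ (Fin.toℕ≤pred[n] j) (Fin.toℕ≤pred[n] i))))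
                   κ₁ κ₂ κ₁≢κ₂ i j
      ; pin = replace-each G pP κ R′ (PathIn G vertices) (λ i → subst vertices (pAt-vx G R′ i) (Sp.spliced⊆ (Fin.toℕ≤pred[n] i)))
                (λ {κ′} κ′≢κ i → side⊆ (inj₁ (subst Z (pAt-vx G (pP κ′) i) (other-Z κ′≢κ (Fin.toℕ≤pred[n] i))))) }
      where
      Disjoint Edges : Path G → Path G → Set
      Disjoint P₁ P₂ = ∀ i j → vx P₁ i ≢ vx P₂ j
      Edges P₁ P₂ = ∀ i j → Adj G (vx P₁ i) (vx P₂ j) ⇔ AtEnds (toℕ i) (len P₁) (toℕ j) (len P₂)
      at-vx : ∀ P₁ P₂ (rel : Fin n → Fin n → Set) i j → rel (pAt G P₁ (toℕ i)) (pAt G P₂ (toℕ j)) → rel (vx P₁ i) (vx P₂ j)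
      at-vx P₁ P₂ rel i j = subst₂ rel (pAt-vx G P₁ i) (pAt-vx G P₂ j)
      flip⇔ : ∀ {u v k l k′ l′} → Adj G u v ⇔ AtEnds k l k′ l′ → Adj G v u ⇔ AtEnds k′ l′ k l
      flip⇔ e = mk⇔ (λ adj → AtEnds-sym (to e (adj-sym G adj))) (λ ends → adj-sym G (from e (AtEnds-sym ends)))

  module PrismSplit {a b Z W} (B : Block G a b Z W) (π : Prism G (Whole G)) where
    open Prism π
    open PrismPaths π
    private
      S = Block.sep B
      module B = Block B
      module Z = Side G S
      module W = Side G (swapSep G S)
      open Separation S
      first last : Fin 3 → Fin n
      first κ = pAt G (pP κ) 0
      last κ = pAt G (pP κ) (len (pP κ))

    module _ (κ₀ : Fin 3) (z₀ : Z (first κ₀)) where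
      private
        first∉W : ∀ κ → ¬ W (first κ)
        first∉W κ w with κ Fin.≟ κ₀
        ... | yes refl = disjoint z₀ w
        ... | no κ≢κ₀ = Z≁W z₀ w (from (prism-adj⇔ (λ e → κ≢κ₀ (sym e)) z≤n z≤n) (inj₁ (refl , refl)))

        -- If some last vertex were in W, every path of the prism would meet {a, b}.
        last∉W : ∀ κ → ¬ W (last κ)
        last∉W κw w = three-in-sep G (λ κ → pAt G (pP κ) (proj₁ (sep-on κ))) (λ κ → proj₂ (proj₂ (sep-on κ)))
                        (λ κ≢κ′ → prism-disjoint κ≢κ′ (proj₁ (proj₂ (sep-on _))) (proj₁ (proj₂ (sep-on _))))
          where
          last∉Z : ∀ κ → ¬ Z (last κ)
          last∉Z κ z with κ Fin.≟ κw
          ... | yes refl = disjoint z w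
          ... | no κ≢κw = Z≁W z w (from (prism-adj⇔ κ≢κw ≤-refl ≤-refl) (inj₂ (refl , refl)))
          sep-on : ∀ κ → ∃[ l ] (l ≤ len (pP κ) × InSep G a b (pAt G (pP κ) l))
          sep-on κ with InSep? G a b (first κ) | InSep? G a b (last κ)
          ... | yes f∈ | _ = 0 , z≤n , f∈
          ... | no _ | yes l∈ = len (pP κ) , ≤-refl , l∈
          ... | no _ | no l∉ with W.exit-before (pAt G (pP κ)) (len (pP κ)) (Z.other (last∉Z κ) l∉) (first∉W κ) (pAt-step G (pP κ))
          ...   | l , l< , l∈ , _ = l , <⇒≤ l< , l∈

        run-at : ∀ κ {l} → l ≤ len (pP κ) → W (pAt G (pP κ) l) → Run G S (pP κ)
        run-at κ l≤ w = proj₁ (run-through G S (pP κ) l≤ w (first∉W κ) (last∉W κ))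

      splice-run : ∀ κ → Run G S (pP κ) → Prism G B.vertices
      splice-run κ ρ = PrismSplice.spliced-prism B π κ ρ only-run
        where
        only-run : ∀ κ′ {l} → l ≤ len (pP κ′) → (κ′ ≡ κ → l ≤ Run.i ρ ⊎ Run.j ρ ≤ l) → ¬ W (pAt G (pP κ′) l)
        only-run κ′ l≤ in-run with κ′ Fin.≟ κ
        ... | yes refl = run-unique G S ρ (first∉W κ) (last∉W κ) l≤ (in-run refl)
        ... | no κ′≢κ = λ w′ → [ (λ e → prism-disjoint κ′≢κ (Run.i≤ (ρ′ w′)) (Run.i≤ ρ) e)
                                , (λ e → prism-disjoint κ′≢κ (Run.i≤ (ρ′ w′)) (Run.j≤ ρ) e) ]′
                                (InSep-third G (Run.sep-i ρ) (Run.sep-j ρ) (Run.i≢j ρ) (Run.sep-i (ρ′ w′)))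
          where
          ρ′ : W (pAt G (pP κ′) _) → Run G S (pP κ′)
          ρ′ = run-at κ′ l≤

      prism-in-block : Prism G B.vertices
      prism-in-block with Fin.any? (λ κ → Fin.any? (λ l → W.dec (vx (pP κ) l)))
      ... | no none = record { pP = pP ; plen = plen ; pdisj = pdisj ; pedges = pedges
                             ; pin = λ κ l → B.side⊆ (Z.within (λ w → none (κ , l , w))) }
      ... | yes (κ , l , w) = splice-run κ (run-at κ (Fin.toℕ≤pred[n] l) (subst W (sym (pAt-vx G (pP κ) l)) w))

  prism-split : ∀ {a b Z W} (B : Block G a b Z W) (B′ : Block G a b W Z) → Prism G (Whole G)
              → Prism G (Block.vertices B) ⊎ Prism G (Block.vertices B′)
  prism-split {a} {b} {Z} {W} B B′ π = by-side (Z⊎W G S (proj₂ off-sep))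
    where
    open Prism π
    open PrismPaths π
    S = Block.sep B
    off-sep : ∃[ κ ] ¬ InSep G a b (pAt G (pP κ) 0)
    off-sep with InSep? G a b (pAt G (pP fzero) 0) | InSep? G a b (pAt G (pP (fsuc fzero)) 0)
    ... | no ∉₀ | _ = fzero , ∉₀
    ... | yes _ | no ∉₁ = fsuc fzero , ∉₁
    ... | yes ∈₀ | yes ∈₁ = ⊥-elim (InSep-nonadj G S ∈₀ ∈₁ (prism-disjoint (λ ()) z≤n z≤n)
                                       (from (prism-adj⇔ (λ ()) z≤n z≤n) (inj₁ (refl , refl))))
    by-side : Z (pAt G (pP (proj₁ off-sep)) 0) ⊎ W (pAt G (pP (proj₁ off-sep)) 0)
            → Prism G (Block.vertices B) ⊎ Prism G (Block.vertices B′)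
    by-side (inj₁ z) = inj₁ (PrismSplit.prism-in-block B π (proj₁ off-sep) z)
    by-side (inj₂ w) = inj₂ (PrismSplit.prism-in-block B′ π (proj₁ off-sep) w)

module _ {n : ℕ} (G : Graph n) where

  free⇔ : ∀ {S₁ S₂ : VSet G} (C : VSet G → Set) → (∀ {S} → C S → C (Whole G)) → (C (Whole G) → C S₁ ⊎ C S₂)
        → (¬ C (Whole G)) ⇔ (¬ C S₁ × ¬ C S₂)
  free⇔ C widen split = mk⇔ (λ free → free ∘′ widen , free ∘′ widen) (λ (free₁ , free₂) c → [ free₁ , free₂ ]′ (split c))

  triangle-whole : ∀ {S} → Triangle G S → Triangle G (Whole G)
  triangle-whole (u , v , w , _ , _ , _ , uv , vw , uw) = u , v , w , tt , tt , tt , uv , vw , uw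

  theta-whole : ∀ {S} → Theta G S → Theta G (Whole G)
  theta-whole θ = record { Theta θ ; tin = λ _ _ → tt }

  prism-whole : ∀ {S} → Prism G S → Prism G (Whole G)
  prism-whole π = record { Prism π ; pin = λ _ _ → tt }

  evenHole-whole : ∀ {S} → EvenHole G S → EvenHole G (Whole G)
  evenHole-whole eh = record { EvenHole eh ; ehin = λ _ → tt }

  evenWheel-whole : ∀ {S} → EvenWheel G S → EvenWheel G (Whole G)
  evenWheel-whole ew = record { EvenWheel ew ; ewinH = λ _ → tt ; ewinc = tt }

  wac-whole : ∀ {S} → Wac G S → Wac G (Whole G)
  wac-whole w = record { Wac w ; winH = λ _ → tt ; winx = tt ; winy = tt }

  turtle-whole : ∀ {S} → Turtle G S → Turtle G (Whole G)
  turtle-whole (w , turtle) = wac-whole w , turtle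

  cwac-whole : ∀ {S} → CWac G S → CWac G (Whole G)
  cwac-whole (w , ¬turtle) = wac-whole w , ¬turtle

  module _ {a b Z W} (B : Block G a b Z W) (B′ : Block G a b W Z) where
    private
      module B = Block B
      module B′ = Block B′

    has⇔ : ∀ κ → Has G κ (Whole G) ⇔ (Has G κ B.vertices × Has G κ B′.vertices)
    has⇔ theta-free = free⇔ (Theta G) theta-whole (theta-split G B B′)
    has⇔ triangle-free = free⇔ (Triangle G) triangle-whole (triangle-split G B B′)
    has⇔ wac-free = free⇔ (Wac G) wac-whole (wac-split G B B′)
    has⇔ turtle-free = free⇔ (Turtle G) turtle-whole (turtle-split G B B′)
    has⇔ c-wac-free = free⇔ (CWac G) cwac-whole (cwac-split G B B′)
    has⇔ even-hole-free = free⇔ (EvenHole G) evenHole-whole (evenHole-split G B B′)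
    has⇔ prism-free = free⇔ (Prism G) prism-whole (prism-split G B B′)
    has⇔ even-wheel-free = free⇔ (EvenWheel G) evenWheel-whole (evenWheel-split G B B′)
    has⇔ bipartite = mk⇔ (λ (col , proper) → (col , λ u v _ _ → proper u v tt tt) , (col , λ u v _ _ → proper u v tt tt))
                         (λ ((col₁ , proper₁) , (col₂ , proper₂)) → bipartite-combine G B B′ col₁ proper₁ col₂ proper₂)

  separation : ∀ {a b X Y} → ProperTwoSep G a b X Y → Separation G a b X Y
  separation ps = record
    { a≢b = a≢b ; a≁b = nonadj ; cover = cover ; a∉Z = Xa ; b∉Z = Xb ; a∉W = Ya ; b∉W = Yb
    ; disjoint = XY _ ; Z≁W = noXY _ _ }
    where open ProperTwoSep ps

lemmal : ∀ {n : ℕ} (G : Graph n) (a b : Fin n) (X Y : VSet G) →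
         ProperTwoSep G a b X Y →
         (P Q : Path G) → IsAZBPath G a X b P → IsAZBPath G a Y b Q →
         (κ : Kind) →
         Has G κ (Whole G) ⇔
           (Has G κ (BlockSet G X a b Q) × Has G κ (BlockSet G Y a b P))
lemmal G a b X Y ps P Q aXb aYb = has⇔ G (mkBlock G S Q aYb) (mkBlock G (swapSep G S) P aXb)
  where S = separation G ps
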